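{- Let $n$, $j$, $q$ be integers with $n,j\ge1$ and $q\ge2$. Then, for each choice of sign (the same sign throughout), \[ \sum_{k=0}^n\binom{n}{k}2^kF_{jk}(\pm\sqrt5F_j)^{n-k}\big(q^{1-(n-k)}-1\big)B_{n-k} =nF_jq^{1-n}\sum_{r=1}^{q-1}\Big((\pm\sqrt5F_jr+qL_j)^{n-1}+(\pm\sqrt5F_j(r-q)+qL_j)^{n-1}\Big). \]
   Context: $F_n$ and $L_n$ denote the Fibonacci and Lucas numbers: $F_0=0,F_1=1$, $L_0=2,L_1=1$, and $u_n=u_{n-1}+u_{n-2}$. The Bernoulli numbers $B_n$ are defined by $\sum_{n\ge0}B_n\frac{z^n}{n!}=\frac{z}{e^z-1}$. -}

module Defs where

open import Data.Nat as ℕ using (ℕ; zero; suc; _∸_)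
open import Data.Nat.Combinatorics using (_C_)
open import Data.Integer as ℤ using (ℤ; +_; -[1+_])
open import Data.Rational as ℚ using (ℚ; 0ℚ; 1ℚ)
open import Data.Rational.Properties as ℚP using ()
open import Data.List using (List; []; _∷_; _++_)
open import Data.Sign using (Sign)
open import Relation.Nullary using (yes; no)

fib : ℕ → ℕ
fib 0 = 0
fib 1 = 1
fib (suc (suc n)) = fib (suc n) ℕ.+ fib n

lucas : ℕ → ℕ
lucas 0 = 2
lucas 1 = 1
lucas (suc (suc n)) = lucas (suc n) ℕ.+ lucas n

ℕ→ℚ : ℕ → ℚ
ℕ→ℚ n = (+ n) ℚ./ 1

-- finite sum  Σ_{k=a}^{b} f k  (empty if b < a)
sumFromTo : ℕ → ℕ → (ℕ → ℚ) → ℚ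
sumFromTo a b f = go (suc b ∸ a)
  where
  go : ℕ → ℚ
  go zero = 0ℚ
  go (suc m) = go m ℚ.+ f (a ℕ.+ m)

nth : List ℚ → ℕ → ℚ
nth [] _ = 0ℚ
nth (x ∷ _) zero = x
nth (_ ∷ xs) (suc k) = nth xs k

-- Bernoulli numbers (convention z/(e^z-1), so B₁ = -1/2), via the
-- standard recurrence  Σ_{k=0}^{m} C(m+1,k) B_k = 0  for m ≥ 1, B₀ = 1.
bernNext : ℕ → List ℚ → ℚ
bernNext zero _ = 1ℚ
bernNext (suc m) l =
  ℚ.- ((+ 1 ℚ./ suc (suc m)) ℚ.*
       sumFromTo 0 m (λ k → ℕ→ℚ (suc (suc m) C k) ℚ.* nth l k))

bernList : ℕ → List ℚ
bernList zero = []
bernList (suc m) = bernList m ++ (bernNext m (bernList m) ∷ [])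

bernoulli : ℕ → ℚ
bernoulli m = nth (bernList (suc m)) m

-- total multiplicative inverse on ℚ (inverse of 0 set to 0; only used at nonzero points)
inv : ℚ → ℚ
inv p with p ℚP.≟ 0ℚ
... | yes _ = 0ℚ
... | no p≢0 = ℚ.1/_ p {{ℚ.≢-nonZero p≢0}}

powℕ : ℚ → ℕ → ℚ
powℕ x zero = 1ℚ
powℕ x (suc m) = x ℚ.* powℕ x m

powℤ : ℚ → ℤ → ℚ
powℤ x (+ m) = powℕ x m
powℤ x -[1+ m ] = inv (powℕ x (suc m))

record Q5 : Set where
  constructor _+√5·_
  field
    re : ℚ
    im : ℚ

infixl 6 _⊕_
infixl 7 _⊗_

_⊕_ : Q5 → Q5 → Q5
(a +√5· b) ⊕ (c +√5· d) = (a ℚ.+ c) +√5· (b ℚ.+ d)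

_⊗_ : Q5 → Q5 → Q5
(a +√5· b) ⊗ (c +√5· d) =
  (a ℚ.* c ℚ.+ (+ 5 ℚ./ 1) ℚ.* b ℚ.* d) +√5· (a ℚ.* d ℚ.+ b ℚ.* c)

embed : ℚ → Q5
embed a = a +√5· 0ℚ

√5 : Q5
√5 = 0ℚ +√5· 1ℚ

pow5 : Q5 → ℕ → Q5
pow5 x zero = embed 1ℚ
pow5 x (suc m) = x ⊗ pow5 x m

sum5 : ℕ → ℕ → (ℕ → Q5) → Q5
sum5 a b f = go (suc b ∸ a)
  where
  go : ℕ → Q5
  go zero = embed 0ℚ
  go (suc m) = go m ⊕ f (a ℕ.+ m)

signℚ : Sign → ℚ
signℚ Sign.+ = 1ℚ
signℚ Sign.- = ℚ.- 1ℚ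

s5F : Sign → ℕ → Q5
s5F s j = embed (signℚ s ℚ.* ℕ→ℚ (fib j)) ⊗ √5

lhs : Sign → ℕ → ℕ → ℕ → Q5
lhs s n j q = sum5 0 n (λ k →
  embed (ℕ→ℚ (n C k) ℚ.* powℕ (ℕ→ℚ 2) k ℚ.* ℕ→ℚ (fib (j ℕ.* k)))
  ⊗ pow5 (s5F s j) (n ∸ k)
  ⊗ embed ((powℤ (ℕ→ℚ q) (+ 1 ℤ.- + (n ∸ k)) ℚ.- 1ℚ) ℚ.* bernoulli (n ∸ k)))

rhs : Sign → ℕ → ℕ → ℕ → Q5
rhs s n j q =
  embed (ℕ→ℚ n ℚ.* ℕ→ℚ (fib j) ℚ.* powℤ (ℕ→ℚ q) (+ 1 ℤ.- + n))
  ⊗ sum5 1 (q ∸ 1) (λ r →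
      pow5 (s5F s j ⊗ embed (ℕ→ℚ r) ⊕ embed (ℕ→ℚ q ℚ.* ℕ→ℚ (lucas j))) (n ∸ 1)
    ⊕ pow5 (s5F s j ⊗ embed (ℕ→ℚ r ℚ.- ℕ→ℚ q) ⊕ embed (ℕ→ℚ q ℚ.* ℕ→ℚ (lucas j))) (n ∸ 1))

module Submission where

-- Write D = ±√5 F_j, L = L_j and α = L + D, ᾱ = L − D; then α^k − ᾱ^k = 2^k F_{jk} (±√5).
-- With H_n(x, d) = Σ_k C(n,k) x^k d^(n−k) B_(n−k) = d^n B_n(x/d), the Bernoulli recurrence gives
-- H_n(x + d, d) − H_n(x, d) = n d x^(n−1).  Multiplied by ±√5, the left side becomes
-- q (H_n(α, D/q) − H_n(ᾱ, D/q)) − (H_n(α, D) − H_n(ᾱ, D)).  Splitting at L = ᾱ + D = α − D and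
-- telescoping once with q steps of size D/q and once with a single step of size D, all that
-- survives is n D Σ_{r=1}^{q−1} ((L + rD/q)^(n−1) + (ᾱ + rD/q)^(n−1)), which is ±√5 times the right side.

open import Defs
open import Data.Nat using (ℕ; _≤_)
open import Data.Sign using (Sign)
open import Relation.Binary.PropositionalEquality using (_≡_)

open import Algebra.Bundles using (CommutativeRing)
open import Algebra.Structures using (IsCommutativeRing)
import Algebra.Properties.Semiring.Mult as SemiringMult
import Algebra.Solver.Ring.Simple as RingSolver
open import Algebra.Solver.Ring.AlmostCommutativeRing using (fromCommutativeRing)
open import Data.Empty using (⊥-elim)
open import Data.Integer as ℤ using (+_)
import Data.Integer.Properties as ℤP
open import Data.List using ([]; _∷_; _++_; length)
open import Data.List.Properties using (length-++)
open import Data.Nat using (zero; suc; _+_; _*_; _∸_; _<_; _!; NonZero; s≤s)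
open import Data.Nat.Combinatorics using (_C_; nCk≡n!/k![n-k]!; k![n∸k]!∣n!; k>n⇒nCk≡0; nCk≡nC[n∸k]; nC1≡n; nCn≡1; nCk+nC[k+1]≡[n+1]C[k+1])
import Data.Nat.Coprimality as Coprime
open import Data.Nat.DivMod using (m/n*n≡m)
open import Data.Nat.Properties
open import Data.Nat.Solver using (module +-*-Solver)
open import Data.Product using (_,_)
open import Data.Rational as ℚ using (ℚ; 0ℚ; 1ℚ; mkℚ)
import Data.Rational.Properties as ℚP
open import Data.Rational.Solver renaming (module +-*-Solver to ℚ-Solver)
open import Data.Sum using (inj₁; inj₂; [_,_]′)
open import Relation.Binary.Definitions using (DecidableEquality)
open import Relation.Binary.PropositionalEquality
  using (refl; sym; trans; cong; cong₂; subst; isEquivalence; module ≡-Reasoning)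
open import Relation.Nullary using (yes; no; ¬_)

2*fib[1+n]≡fib+lucas : ∀ n → 2 * fib (suc n) ≡ fib n + lucas n
2*fib[1+n]≡fib+lucas 0 = refl
2*fib[1+n]≡fib+lucas 1 = refl
2*fib[1+n]≡fib+lucas (suc (suc n)) = begin
  2 * (fib (suc (suc n)) + fib (suc n))         ≡⟨ *-distribˡ-+ 2 (fib (suc (suc n))) (fib (suc n)) ⟩
  2 * fib (suc (suc n)) + 2 * fib (suc n)       ≡⟨ cong₂ _+_ (2*fib[1+n]≡fib+lucas (suc n)) (2*fib[1+n]≡fib+lucas n) ⟩
  (fib (suc n) + lucas (suc n)) + (fib n + lucas n)
    ≡⟨ solve 4 (λ a b c d → (a :+ b) :+ (c :+ d) := (a :+ c) :+ (b :+ d)) refl (fib (suc n)) (lucas (suc n)) (fib n) (lucas n) ⟩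
  fib (suc (suc n)) + lucas (suc (suc n))       ∎
  where open ≡-Reasoning; open +-*-Solver

2*lucas[1+n]≡lucas+5*fib : ∀ n → 2 * lucas (suc n) ≡ lucas n + 5 * fib n
2*lucas[1+n]≡lucas+5*fib 0 = refl
2*lucas[1+n]≡lucas+5*fib 1 = refl
2*lucas[1+n]≡lucas+5*fib (suc (suc n)) = begin
  2 * (lucas (suc (suc n)) + lucas (suc n))     ≡⟨ *-distribˡ-+ 2 (lucas (suc (suc n))) (lucas (suc n)) ⟩
  2 * lucas (suc (suc n)) + 2 * lucas (suc n)   ≡⟨ cong₂ _+_ (2*lucas[1+n]≡lucas+5*fib (suc n)) (2*lucas[1+n]≡lucas+5*fib n) ⟩
  (lucas (suc n) + 5 * fib (suc n)) + (lucas n + 5 * fib n)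
    ≡⟨ solve 4 (λ a b c d → (a :+ con 5 :* b) :+ (c :+ con 5 :* d) := (a :+ c) :+ con 5 :* (b :+ d)) refl
         (lucas (suc n)) (fib (suc n)) (lucas n) (fib n) ⟩
  lucas (suc (suc n)) + 5 * fib (suc (suc n))   ∎
  where open ≡-Reasoning; open +-*-Solver

2*fib[m+n]≡lucas*fib+fib*lucas : ∀ m n → 2 * fib (m + n) ≡ lucas m * fib n + fib m * lucas n
2*fib[m+n]≡lucas*fib+fib*lucas 0 n =
  solve 2 (λ f l → con 2 :* f := con 2 :* f :+ con 0 :* l) refl (fib n) (lucas n)
  where open +-*-Solver
2*fib[m+n]≡lucas*fib+fib*lucas 1 n =
  trans (2*fib[1+n]≡fib+lucas n) (solve 2 (λ f l → f :+ l := con 1 :* f :+ con 1 :* l) refl (fib n) (lucas n))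
  where open +-*-Solver
2*fib[m+n]≡lucas*fib+fib*lucas (suc (suc m)) n = begin
  2 * (fib (suc m + n) + fib (m + n))           ≡⟨ *-distribˡ-+ 2 (fib (suc m + n)) (fib (m + n)) ⟩
  2 * fib (suc m + n) + 2 * fib (m + n)         ≡⟨ cong₂ _+_ (2*fib[m+n]≡lucas*fib+fib*lucas (suc m) n) (2*fib[m+n]≡lucas*fib+fib*lucas m n) ⟩
  (lucas (suc m) * fib n + fib (suc m) * lucas n) + (lucas m * fib n + fib m * lucas n)
    ≡⟨ solve 6 (λ l₁ f₁ l₀ f₀ f l → (l₁ :* f :+ f₁ :* l) :+ (l₀ :* f :+ f₀ :* l) := (l₁ :+ l₀) :* f :+ (f₁ :+ f₀) :* l) refl
         (lucas (suc m)) (fib (suc m)) (lucas m) (fib m) (fib n) (lucas n) ⟩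
  (lucas (suc m) + lucas m) * fib n + (fib (suc m) + fib m) * lucas n ∎
  where open ≡-Reasoning; open +-*-Solver

2*lucas[m+n]≡lucas*lucas+5*fib*fib : ∀ m n → 2 * lucas (m + n) ≡ lucas m * lucas n + 5 * fib m * fib n
2*lucas[m+n]≡lucas*lucas+5*fib*fib 0 n =
  solve 2 (λ f l → con 2 :* l := con 2 :* l :+ con 5 :* con 0 :* f) refl (fib n) (lucas n)
  where open +-*-Solver
2*lucas[m+n]≡lucas*lucas+5*fib*fib 1 n =
  trans (2*lucas[1+n]≡lucas+5*fib n) (solve 2 (λ f l → l :+ con 5 :* f := con 1 :* l :+ con 5 :* con 1 :* f) refl (fib n) (lucas n))
  where open +-*-Solver
2*lucas[m+n]≡lucas*lucas+5*fib*fib (suc (suc m)) n = begin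
  2 * (lucas (suc m + n) + lucas (m + n))       ≡⟨ *-distribˡ-+ 2 (lucas (suc m + n)) (lucas (m + n)) ⟩
  2 * lucas (suc m + n) + 2 * lucas (m + n)     ≡⟨ cong₂ _+_ (2*lucas[m+n]≡lucas*lucas+5*fib*fib (suc m) n) (2*lucas[m+n]≡lucas*lucas+5*fib*fib m n) ⟩
  (lucas (suc m) * lucas n + 5 * fib (suc m) * fib n) + (lucas m * lucas n + 5 * fib m * fib n)
    ≡⟨ solve 6 (λ l₁ f₁ l₀ f₀ f l → (l₁ :* l :+ con 5 :* f₁ :* f) :+ (l₀ :* l :+ con 5 :* f₀ :* f) := (l₁ :+ l₀) :* l :+ con 5 :* (f₁ :+ f₀) :* f) refl
         (lucas (suc m)) (fib (suc m)) (lucas m) (fib m) (fib n) (lucas n) ⟩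
  (lucas (suc m) + lucas m) * lucas n + 5 * (fib (suc m) + fib m) * fib n ∎
  where open ≡-Reasoning; open +-*-Solver

nCk*[k!*[n∸k]!]≡n! : ∀ {n k} → k ≤ n → (n C k) * (k ! * (n ∸ k) !) ≡ n !
nCk*[k!*[n∸k]!]≡n! {n} {k} k≤n =
  trans (cong (_* (k ! * (n ∸ k) !)) (nCk≡n!/k![n-k]! k≤n)) (m/n*n≡m {{k !* (n ∸ k) !≢0}} (k![n∸k]!∣n! k≤n))

[1+n]Cn≡1+n : ∀ n → suc n C n ≡ suc n
[1+n]Cn≡1+n n = begin
  suc n C n             ≡⟨ nCk≡nC[n∸k] (n≤1+n n) ⟩
  suc n C (suc n ∸ n)   ≡⟨ cong (suc n C_) (m+n∸n≡m 1 n) ⟩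
  suc n C 1             ≡⟨ nC1≡n (suc n) ⟩
  suc n                 ∎
  where open ≡-Reasoning

nCk*kCi≡nCi*[n∸i]C[n∸k] : ∀ {n k i} → i ≤ k → k ≤ n → (n C k) * (k C i) ≡ (n C i) * ((n ∸ i) C (n ∸ k))
nCk*kCi≡nCi*[n∸i]C[n∸k] {n} {k} {i} i≤k k≤n =
  -- both sides times i! (k∸i)! (n∸k)! equal n!
  *-cancelʳ-≡ _ _ (i ! * ((k ∸ i) ! * (n ∸ k) !)) {{nonZero}} (trans left (sym right))
  where
  open ≡-Reasoning
  open +-*-Solver
  nonZero : NonZero (i ! * ((k ∸ i) ! * (n ∸ k) !))
  nonZero = m*n≢0 _ _ {{i !≢0}} {{m*n≢0 _ _ {{(k ∸ i) !≢0}} {{(n ∸ k) !≢0}}}}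
  [n∸i]∸[n∸k]≡k∸i : (n ∸ i) ∸ (n ∸ k) ≡ k ∸ i
  [n∸i]∸[n∸k]≡k∸i = begin
    (n ∸ i) ∸ (n ∸ k)             ≡⟨ cong (λ z → (z ∸ i) ∸ (n ∸ k)) (sym (m∸n+n≡m k≤n)) ⟩
    ((n ∸ k + k) ∸ i) ∸ (n ∸ k)   ≡⟨ cong (_∸ (n ∸ k)) (+-∸-assoc (n ∸ k) i≤k) ⟩
    ((n ∸ k) + (k ∸ i)) ∸ (n ∸ k) ≡⟨ m+n∸m≡n (n ∸ k) (k ∸ i) ⟩
    k ∸ i                         ∎
  left : (n C k) * (k C i) * (i ! * ((k ∸ i) ! * (n ∸ k) !)) ≡ n !
  left = begin
    (n C k) * (k C i) * (i ! * ((k ∸ i) ! * (n ∸ k) !))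
      ≡⟨ solve 5 (λ a b c d e → a :* b :* (c :* (d :* e)) := a :* (b :* (c :* d) :* e)) refl
           (n C k) (k C i) (i !) ((k ∸ i) !) ((n ∸ k) !) ⟩
    (n C k) * ((k C i) * (i ! * (k ∸ i) !) * (n ∸ k) !)
      ≡⟨ cong (λ z → (n C k) * (z * (n ∸ k) !)) (nCk*[k!*[n∸k]!]≡n! i≤k) ⟩
    (n C k) * (k ! * (n ∸ k) !)
      ≡⟨ nCk*[k!*[n∸k]!]≡n! k≤n ⟩
    n ! ∎
  right : (n C i) * ((n ∸ i) C (n ∸ k)) * (i ! * ((k ∸ i) ! * (n ∸ k) !)) ≡ n !
  right = begin
    (n C i) * ((n ∸ i) C (n ∸ k)) * (i ! * ((k ∸ i) ! * (n ∸ k) !))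
      ≡⟨ solve 5 (λ a b c d e → a :* b :* (c :* (d :* e)) := a :* (c :* (b :* (e :* d)))) refl
           (n C i) ((n ∸ i) C (n ∸ k)) (i !) ((k ∸ i) !) ((n ∸ k) !) ⟩
    (n C i) * (i ! * (((n ∸ i) C (n ∸ k)) * ((n ∸ k) ! * (k ∸ i) !)))
      ≡⟨ cong (λ z → (n C i) * (i ! * (((n ∸ i) C (n ∸ k)) * ((n ∸ k) ! * z !)))) (sym [n∸i]∸[n∸k]≡k∸i) ⟩
    (n C i) * (i ! * (((n ∸ i) C (n ∸ k)) * ((n ∸ k) ! * ((n ∸ i) ∸ (n ∸ k)) !)))
      ≡⟨ cong (λ z → (n C i) * (i ! * z)) (nCk*[k!*[n∸k]!]≡n! (∸-monoʳ-≤ n i≤k)) ⟩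
    (n C i) * (i ! * (n ∸ i) !)
      ≡⟨ nCk*[k!*[n∸k]!]≡n! (≤-trans i≤k k≤n) ⟩
    n ! ∎

-- The field ℚ(√5) as a commutative ring

0₅ 1₅ : Q5
0₅ = embed 0ℚ
1₅ = embed 1ℚ

infix 8 ⊖_
⊖_ : Q5 → Q5
⊖ (a +√5· b) = (ℚ.- a) +√5· (ℚ.- b)

infixl 6 _⊝_
_⊝_ : Q5 → Q5 → Q5
x ⊝ y = x ⊕ ⊖ y

five : ℚ
five = + 5 ℚ./ 1

⊕-assoc : ∀ x y z → (x ⊕ y) ⊕ z ≡ x ⊕ (y ⊕ z)
⊕-assoc (a +√5· b) (c +√5· d) (e +√5· f) = cong₂ _+√5·_ (ℚP.+-assoc a c e) (ℚP.+-assoc b d f)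

⊕-comm : ∀ x y → x ⊕ y ≡ y ⊕ x
⊕-comm (a +√5· b) (c +√5· d) = cong₂ _+√5·_ (ℚP.+-comm a c) (ℚP.+-comm b d)

⊕-identityˡ : ∀ x → 0₅ ⊕ x ≡ x
⊕-identityˡ (a +√5· b) = cong₂ _+√5·_ (ℚP.+-identityˡ a) (ℚP.+-identityˡ b)

⊕-identityʳ : ∀ x → x ⊕ 0₅ ≡ x
⊕-identityʳ (a +√5· b) = cong₂ _+√5·_ (ℚP.+-identityʳ a) (ℚP.+-identityʳ b)

⊕-inverseˡ : ∀ x → ⊖ x ⊕ x ≡ 0₅
⊕-inverseˡ (a +√5· b) = cong₂ _+√5·_ (ℚP.+-inverseˡ a) (ℚP.+-inverseˡ b)

⊕-inverseʳ : ∀ x → x ⊕ ⊖ x ≡ 0₅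
⊕-inverseʳ (a +√5· b) = cong₂ _+√5·_ (ℚP.+-inverseʳ a) (ℚP.+-inverseʳ b)

⊗-assoc : ∀ x y z → (x ⊗ y) ⊗ z ≡ x ⊗ (y ⊗ z)
⊗-assoc (a +√5· b) (c +√5· d) (e +√5· f) = cong₂ _+√5·_
  (solve 7 (λ a b c d e f k → (a :* c :+ k :* b :* d) :* e :+ k :* (a :* d :+ b :* c) :* f
                          := a :* (c :* e :+ k :* d :* f) :+ k :* b :* (c :* f :+ d :* e)) refl a b c d e f five)
  (solve 7 (λ a b c d e f k → (a :* c :+ k :* b :* d) :* f :+ (a :* d :+ b :* c) :* e
                          := a :* (c :* f :+ d :* e) :+ b :* (c :* e :+ k :* d :* f)) refl a b c d e f five)
  where open ℚ-Solver

⊗-comm : ∀ x y → x ⊗ y ≡ y ⊗ x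
⊗-comm (a +√5· b) (c +√5· d) = cong₂ _+√5·_
  (solve 5 (λ a b c d k → a :* c :+ k :* b :* d := c :* a :+ k :* d :* b) refl a b c d five)
  (solve 4 (λ a b c d → a :* d :+ b :* c := c :* b :+ d :* a) refl a b c d)
  where open ℚ-Solver

⊗-identityˡ : ∀ x → 1₅ ⊗ x ≡ x
⊗-identityˡ (a +√5· b) = cong₂ _+√5·_
  (solve 3 (λ a b k → con 1ℚ :* a :+ k :* con 0ℚ :* b := a) refl a b five)
  (solve 2 (λ a b → con 1ℚ :* b :+ con 0ℚ :* a := b) refl a b)
  where open ℚ-Solver

⊗-identityʳ : ∀ x → x ⊗ 1₅ ≡ x
⊗-identityʳ x = trans (⊗-comm x 1₅) (⊗-identityˡ x)

⊗-distribˡ-⊕ : ∀ x y z → x ⊗ (y ⊕ z) ≡ x ⊗ y ⊕ x ⊗ z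
⊗-distribˡ-⊕ (a +√5· b) (c +√5· d) (e +√5· f) = cong₂ _+√5·_
  (solve 7 (λ a b c d e f k → a :* (c :+ e) :+ k :* b :* (d :+ f)
                          := (a :* c :+ k :* b :* d) :+ (a :* e :+ k :* b :* f)) refl a b c d e f five)
  (solve 6 (λ a b c d e f → a :* (d :+ f) :+ b :* (c :+ e)
                          := (a :* d :+ b :* c) :+ (a :* f :+ b :* e)) refl a b c d e f)
  where open ℚ-Solver

⊗-distribʳ-⊕ : ∀ x y z → (y ⊕ z) ⊗ x ≡ y ⊗ x ⊕ z ⊗ x
⊗-distribʳ-⊕ x y z =
  trans (⊗-comm (y ⊕ z) x) (trans (⊗-distribˡ-⊕ x y z) (cong₂ _⊕_ (⊗-comm x y) (⊗-comm x z)))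

_≟₅_ : DecidableEquality Q5
(a +√5· b) ≟₅ (c +√5· d) with a ℚP.≟ c | b ℚP.≟ d
... | yes refl | yes refl = yes refl
... | no a≢c   | _        = no λ { refl → a≢c refl }
... | yes _    | no b≢d   = no λ { refl → b≢d refl }

Q5-isCommutativeRing : IsCommutativeRing _≡_ _⊕_ _⊗_ ⊖_ 0₅ 1₅
Q5-isCommutativeRing = record
  { isRing = record
    { +-isAbelianGroup = record
      { isGroup = record
        { isMonoid = record
          { isSemigroup = record
            { isMagma = record { isEquivalence = isEquivalence ; ∙-cong = cong₂ _⊕_ }
            ; assoc = ⊕-assoc }
          ; identity = ⊕-identityˡ , ⊕-identityʳ }
        ; inverse = ⊕-inverseˡ , ⊕-inverseʳ
        ; ⁻¹-cong = cong ⊖_ }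
      ; comm = ⊕-comm }
    ; *-cong = cong₂ _⊗_
    ; *-assoc = ⊗-assoc
    ; *-identity = ⊗-identityˡ , ⊗-identityʳ
    ; distrib = ⊗-distribˡ-⊕ , ⊗-distribʳ-⊕ }
  ; *-comm = ⊗-comm }

Q5-commutativeRing : CommutativeRing _ _
Q5-commutativeRing = record { isCommutativeRing = Q5-isCommutativeRing }

module Q5-Solver = RingSolver (fromCommutativeRing Q5-commutativeRing) _≟₅_

embed-* : ∀ a b → embed (a ℚ.* b) ≡ embed a ⊗ embed b
embed-* a b = cong₂ _+√5·_
  (solve 3 (λ a b k → a :* b := a :* b :+ k :* con 0ℚ :* con 0ℚ) refl a b five)
  (solve 2 (λ a b → con 0ℚ := a :* con 0ℚ :+ con 0ℚ :* b) refl a b)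
  where open ℚ-Solver

embed-pow : ∀ a n → embed (powℕ a n) ≡ pow5 (embed a) n
embed-pow a zero    = refl
embed-pow a (suc n) = trans (embed-* a (powℕ a n)) (cong (embed a ⊗_) (embed-pow a n))

pow5-+ : ∀ x m n → pow5 x (m + n) ≡ pow5 x m ⊗ pow5 x n
pow5-+ x zero    n = sym (⊗-identityˡ (pow5 x n))
pow5-+ x (suc m) n = trans (cong (x ⊗_) (pow5-+ x m n)) (sym (⊗-assoc x (pow5 x m) (pow5 x n)))

pow5-distrib-⊗ : ∀ x y n → pow5 (x ⊗ y) n ≡ pow5 x n ⊗ pow5 y n
pow5-distrib-⊗ x y zero    = sym (⊗-identityˡ 1₅)
pow5-distrib-⊗ x y (suc n) = trans (cong ((x ⊗ y) ⊗_) (pow5-distrib-⊗ x y n))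
  (solve 4 (λ x y a b → (x :* y) :* (a :* b) := (x :* a) :* (y :* b)) refl x y (pow5 x n) (pow5 y n))
  where open Q5-Solver

ℕ→ℚ-suc : ∀ n → ℕ→ℚ (suc n) ≡ 1ℚ ℚ.+ ℕ→ℚ n
ℕ→ℚ-suc n = trans (ℚP./-cong {+ suc n} {1} {+ 1 ℤ.+ (+ n ℤ.* + 1)} (cong (λ z → + 1 ℤ.+ z) (sym (ℤP.*-identityʳ (+ n)))) refl)
                  (cong (1ℚ ℚ.+_) (sym (ℚP.normalize-coprime (Coprime.sym (Coprime.1-coprimeTo n)))))

ι : ℕ → Q5
ι n = embed (ℕ→ℚ n)

open SemiringMult (CommutativeRing.semiring Q5-commutativeRing) using (_×_; ×-homo-+; ×1-homo-*)

ι≡×1₅ : ∀ n → ι n ≡ n × 1₅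
ι≡×1₅ zero    = refl
ι≡×1₅ (suc n) = trans (cong embed (ℕ→ℚ-suc n)) (cong (1₅ ⊕_) (ι≡×1₅ n))

ι-+ : ∀ m n → ι (m + n) ≡ ι m ⊕ ι n
ι-+ m n = trans (ι≡×1₅ (m + n)) (trans (×-homo-+ 1₅ m n) (sym (cong₂ _⊕_ (ι≡×1₅ m) (ι≡×1₅ n))))

ι-* : ∀ m n → ι (m * n) ≡ ι m ⊗ ι n
ι-* m n = trans (ι≡×1₅ (m * n)) (trans (×1-homo-* m n) (sym (cong₂ _⊗_ (ι≡×1₅ m) (ι≡×1₅ n))))

∑ : ℕ → (ℕ → Q5) → Q5
∑ zero    f = 0₅
∑ (suc n) f = ∑ n f ⊕ f n

sum5-0≡∑ : ∀ n f → sum5 0 n f ≡ ∑ (suc n) f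
sum5-0≡∑ zero    f = refl
sum5-0≡∑ (suc n) f = cong (_⊕ f (suc n)) (sum5-0≡∑ n f)

sum5-1≡∑ : ∀ n f → sum5 1 n f ≡ ∑ n (λ r → f (suc r))
sum5-1≡∑ zero    f = refl
sum5-1≡∑ (suc n) f = cong (_⊕ f (suc n)) (sum5-1≡∑ n f)

∑-cong-< : ∀ n {f g} → (∀ k → k < n → f k ≡ g k) → ∑ n f ≡ ∑ n g
∑-cong-< zero    f≡g = refl
∑-cong-< (suc n) f≡g = cong₂ _⊕_ (∑-cong-< n (λ k k<n → f≡g k (m<n⇒m<1+n k<n))) (f≡g n (n<1+n n))

∑-cong : ∀ n {f g} → (∀ k → f k ≡ g k) → ∑ n f ≡ ∑ n g
∑-cong n f≡g = ∑-cong-< n (λ k _ → f≡g k)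

∑-zero : ∀ n {f} → (∀ k → k < n → f k ≡ 0₅) → ∑ n f ≡ 0₅
∑-zero zero    f≡0 = refl
∑-zero (suc n) f≡0 = trans (cong₂ _⊕_ (∑-zero n (λ k k<n → f≡0 k (m<n⇒m<1+n k<n))) (f≡0 n (n<1+n n))) (⊕-identityʳ 0₅)

∑-⊕ : ∀ n f g → ∑ n (λ k → f k ⊕ g k) ≡ ∑ n f ⊕ ∑ n g
∑-⊕ zero    f g = sym (⊕-identityˡ 0₅)
∑-⊕ (suc n) f g = trans (cong (_⊕ (f n ⊕ g n)) (∑-⊕ n f g))
  (solve 4 (λ a b c d → (a :+ b) :+ (c :+ d) := (a :+ c) :+ (b :+ d)) refl (∑ n f) (∑ n g) (f n) (g n))
  where open Q5-Solver

∑-⊗ˡ : ∀ n c f → c ⊗ ∑ n f ≡ ∑ n (λ k → c ⊗ f k)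
∑-⊗ˡ zero    c f = solve 1 (λ c → c :* con 0₅ := con 0₅) refl c
  where open Q5-Solver
∑-⊗ˡ (suc n) c f = trans (⊗-distribˡ-⊕ c (∑ n f) (f n)) (cong (_⊕ c ⊗ f n) (∑-⊗ˡ n c f))

∑-⊗ʳ : ∀ n c f → ∑ n f ⊗ c ≡ ∑ n (λ k → f k ⊗ c)
∑-⊗ʳ n c f = trans (⊗-comm (∑ n f) c) (trans (∑-⊗ˡ n c f) (∑-cong n (λ k → ⊗-comm c (f k))))

∑-⊝ : ∀ n f g → ∑ n (λ k → f k ⊝ g k) ≡ ∑ n f ⊝ ∑ n g
∑-⊝ n f g = begin
  ∑ n (λ k → f k ⊝ g k)            ≡⟨ ∑-⊕ n f (λ k → ⊖ g k) ⟩
  ∑ n f ⊕ ∑ n (λ k → ⊖ g k)        ≡⟨ cong (∑ n f ⊕_) (∑-cong n (λ k → sym (⊖≡⊖1⊗ (g k)))) ⟩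
  ∑ n f ⊕ ∑ n (λ k → ⊖ 1₅ ⊗ g k)   ≡⟨ cong (∑ n f ⊕_) (sym (∑-⊗ˡ n (⊖ 1₅) g)) ⟩
  ∑ n f ⊕ ⊖ 1₅ ⊗ ∑ n g             ≡⟨ cong (∑ n f ⊕_) (⊖≡⊖1⊗ (∑ n g)) ⟩
  ∑ n f ⊝ ∑ n g                    ∎
  where
  open ≡-Reasoning
  ⊖≡⊖1⊗ : ∀ x → ⊖ 1₅ ⊗ x ≡ ⊖ x
  ⊖≡⊖1⊗ x = solve 1 (λ x → :- con 1₅ :* x := :- x) refl x
    where open Q5-Solver

∑-shift : ∀ n f → ∑ (suc n) f ≡ f 0 ⊕ ∑ n (λ k → f (suc k))
∑-shift zero    f = trans (⊕-identityˡ (f 0)) (sym (⊕-identityʳ (f 0)))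
∑-shift (suc n) f = trans (cong (_⊕ f (suc n)) (∑-shift n f)) (⊕-assoc (f 0) _ _)

∑-+ : ∀ m n f → ∑ (m + n) f ≡ ∑ m f ⊕ ∑ n (λ k → f (m + k))
∑-+ m zero    f = trans (cong (λ z → ∑ z f) (+-identityʳ m)) (sym (⊕-identityʳ (∑ m f)))
∑-+ m (suc n) f = begin
  ∑ (m + suc n) f                              ≡⟨ cong (λ z → ∑ z f) (+-suc m n) ⟩
  ∑ (m + n) f ⊕ f (m + n)                      ≡⟨ cong (_⊕ f (m + n)) (∑-+ m n f) ⟩
  ∑ m f ⊕ ∑ n (λ k → f (m + k)) ⊕ f (m + n)    ≡⟨ ⊕-assoc (∑ m f) _ _ ⟩
  ∑ m f ⊕ ∑ (suc n) (λ k → f (m + k))          ∎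
  where open ≡-Reasoning

∑-pad : ∀ m n f → (∀ k → n ≤ k → f k ≡ 0₅) → ∑ (m + n) f ≡ ∑ n f
∑-pad m n f f≡0 = begin
  ∑ (m + n) f                        ≡⟨ cong (λ z → ∑ z f) (+-comm m n) ⟩
  ∑ (n + m) f                        ≡⟨ ∑-+ n m f ⟩
  ∑ n f ⊕ ∑ m (λ k → f (n + k))      ≡⟨ cong (∑ n f ⊕_) (∑-zero m (λ k _ → f≡0 (n + k) (m≤m+n n k))) ⟩
  ∑ n f ⊕ 0₅                         ≡⟨ ⊕-identityʳ _ ⟩
  ∑ n f                              ∎
  where open ≡-Reasoning

∑-swap : ∀ m n (f : ℕ → ℕ → Q5) → ∑ m (λ i → ∑ n (f i)) ≡ ∑ n (λ k → ∑ m (λ i → f i k))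
∑-swap zero    n f = sym (∑-zero n (λ _ _ → refl))
∑-swap (suc m) n f = trans (cong (_⊕ ∑ n (f m)) (∑-swap m n f)) (sym (∑-⊕ n (λ k → ∑ m (λ i → f i k)) (f m)))

∑-reverse : ∀ n f → ∑ (suc n) (λ k → f (n ∸ k)) ≡ ∑ (suc n) f
∑-reverse zero    f = refl
∑-reverse (suc n) f = begin
  ∑ (suc (suc n)) (λ k → f (suc n ∸ k))           ≡⟨ ∑-shift (suc n) (λ k → f (suc n ∸ k)) ⟩
  f (suc n) ⊕ ∑ (suc n) (λ k → f (n ∸ k))         ≡⟨ cong (f (suc n) ⊕_) (∑-reverse n f) ⟩
  f (suc n) ⊕ ∑ (suc n) f                         ≡⟨ ⊕-comm (f (suc n)) (∑ (suc n) f) ⟩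
  ∑ (suc (suc n)) f                               ∎
  where open ≡-Reasoning

binomialTerm : ℕ → Q5 → Q5 → ℕ → Q5
binomialTerm k x y i = ι (k C i) ⊗ pow5 x i ⊗ pow5 y (k ∸ i)

binomialTerm-≡0 : ∀ k x y i → k < i → binomialTerm k x y i ≡ 0₅
binomialTerm-≡0 k x y i k<i = trans (cong (λ c → ι c ⊗ pow5 x i ⊗ pow5 y (k ∸ i)) (k>n⇒nCk≡0 k<i))
  (solve 2 (λ a b → con 0₅ :* a :* b := con 0₅) refl (pow5 x i) (pow5 y (k ∸ i)))
  where open Q5-Solver

binomial : ∀ k x y → pow5 (x ⊕ y) k ≡ ∑ (suc k) (binomialTerm k x y)
binomial zero    x y = sym (⊕-identityˡ _)
binomial (suc k) x y = begin
  (x ⊕ y) ⊗ pow5 (x ⊕ y) k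
    ≡⟨ cong ((x ⊕ y) ⊗_) (binomial k x y) ⟩
  (x ⊕ y) ⊗ ∑ (suc k) (binomialTerm k x y)
    ≡⟨ ⊗-distribʳ-⊕ _ x y ⟩
  x ⊗ ∑ (suc k) (binomialTerm k x y) ⊕ y ⊗ ∑ (suc k) (binomialTerm k x y)
    ≡⟨ cong₂ _⊕_ (trans (∑-⊗ˡ (suc k) x _) (∑-cong (suc k) x⊗term))
                 (trans (∑-⊗ˡ (suc k) y _) (trans (∑-cong-< (suc k) y⊗term) (sym (∑-pad 1 (suc k) v v≡0)))) ⟩
  ∑ (suc k) u ⊕ ∑ (suc (suc k)) v
    ≡⟨ cong (∑ (suc k) u ⊕_) (∑-shift (suc k) v) ⟩
  ∑ (suc k) u ⊕ (v 0 ⊕ ∑ (suc k) (λ i → v (suc i)))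
    ≡⟨ solve 3 (λ a b c → a :+ (b :+ c) := b :+ (a :+ c)) refl (∑ (suc k) u) (v 0) (∑ (suc k) (λ i → v (suc i))) ⟩
  v 0 ⊕ (∑ (suc k) u ⊕ ∑ (suc k) (λ i → v (suc i)))
    ≡⟨ cong (v 0 ⊕_) (sym (∑-⊕ (suc k) u (λ i → v (suc i)))) ⟩
  v 0 ⊕ ∑ (suc k) (λ i → u i ⊕ v (suc i))
    ≡⟨ cong (v 0 ⊕_) (∑-cong (suc k) pascal) ⟩
  binomialTerm (suc k) x y 0 ⊕ ∑ (suc k) (λ i → binomialTerm (suc k) x y (suc i))
    ≡⟨ sym (∑-shift (suc k) (binomialTerm (suc k) x y)) ⟩
  ∑ (suc (suc k)) (binomialTerm (suc k) x y) ∎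
  where
  open ≡-Reasoning
  open Q5-Solver
  u v : ℕ → Q5
  u i = ι (k C i) ⊗ pow5 x (suc i) ⊗ pow5 y (k ∸ i)
  v i = ι (k C i) ⊗ pow5 x i ⊗ pow5 y (suc k ∸ i)
  x⊗term : ∀ i → x ⊗ binomialTerm k x y i ≡ u i
  x⊗term i = solve 4 (λ x c a b → x :* (c :* a :* b) := c :* (x :* a) :* b) refl
    x (ι (k C i)) (pow5 x i) (pow5 y (k ∸ i))
  y⊗term : ∀ i → i < suc k → y ⊗ binomialTerm k x y i ≡ v i
  y⊗term i (s≤s i≤k) = trans
    (solve 4 (λ y c a b → y :* (c :* a :* b) := c :* a :* (y :* b)) refl y (ι (k C i)) (pow5 x i) (pow5 y (k ∸ i)))
    (cong (λ t → ι (k C i) ⊗ pow5 x i ⊗ pow5 y t) (sym (+-∸-assoc 1 i≤k)))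
  v≡0 : ∀ i → suc k ≤ i → v i ≡ 0₅
  v≡0 i k<i = trans (cong (λ c → ι c ⊗ pow5 x i ⊗ pow5 y (suc k ∸ i)) (k>n⇒nCk≡0 k<i))
    (solve 2 (λ a b → con 0₅ :* a :* b := con 0₅) refl (pow5 x i) (pow5 y (suc k ∸ i)))
  pascal : ∀ i → u i ⊕ v (suc i) ≡ binomialTerm (suc k) x y (suc i)
  pascal i = trans
    (solve 4 (λ c d a b → c :* a :* b :+ d :* a :* b := (c :+ d) :* a :* b) refl
       (ι (k C i)) (ι (k C suc i)) (pow5 x (suc i)) (pow5 y (k ∸ i)))
    (cong (λ c → c ⊗ pow5 x (suc i) ⊗ pow5 y (k ∸ i))
       (trans (sym (ι-+ (k C i) (k C suc i))) (cong ι (nCk+nC[k+1]≡[n+1]C[k+1] k i))))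

binomial-≤ : ∀ n k x y → k ≤ n → pow5 (x ⊕ y) k ≡ ∑ (suc n) (binomialTerm k x y)
binomial-≤ n k x y k≤n = begin
  pow5 (x ⊕ y) k                               ≡⟨ binomial k x y ⟩
  ∑ (suc k) (binomialTerm k x y)               ≡⟨ sym (∑-pad (n ∸ k) (suc k) _ (λ i k<i → binomialTerm-≡0 k x y i k<i)) ⟩
  ∑ (n ∸ k + suc k) (binomialTerm k x y)       ≡⟨ cong (λ z → ∑ z (binomialTerm k x y)) (trans (+-suc (n ∸ k) k) (cong suc (m∸n+n≡m k≤n))) ⟩
  ∑ (suc n) (binomialTerm k x y)               ∎
  where open ≡-Reasoning

uv≡1⇒a⊕[uv⊝1]⊗b≡a : ∀ u v → u ⊗ v ≡ 1₅ → ∀ a b → a ⊕ (u ⊗ v ⊝ 1₅) ⊗ b ≡ a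
uv≡1⇒a⊕[uv⊝1]⊗b≡a u v uv≡1 a b = trans (cong (λ w → a ⊕ (w ⊝ 1₅) ⊗ b) uv≡1)
  (solve 2 (λ a b → a :+ (con 1₅ :+ :- con 1₅) :* b := a) refl a b)
  where open Q5-Solver

-- Homogeneous Bernoulli polynomials d^n B_n(x/d)

module HomogeneousBernoulli
  (β : ℕ → Q5) (β₀≡1 : β 0 ≡ 1₅)
  (β-rec : ∀ m → ∑ (suc (suc m)) (λ k → ι (suc (suc m) C k) ⊗ β k) ≡ 0₅)
  where

  δ₁ : ℕ → Q5
  δ₁ 1 = 1₅
  δ₁ _ = 0₅

  ∑-binomial-β : ∀ N → ∑ (suc N) (λ u → ι (N C u) ⊗ β u) ≡ β N ⊕ δ₁ N
  ∑-binomial-β 0 = solve 1 (λ b → con 0₅ :+ con 1₅ :* b := b :+ con 0₅) refl (β 0)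
    where open Q5-Solver
  ∑-binomial-β 1 = trans (cong (λ b → 0₅ ⊕ 1₅ ⊗ b ⊕ 1₅ ⊗ β 1) β₀≡1)
    (solve 1 (λ b → con 0₅ :+ con 1₅ :* con 1₅ :+ con 1₅ :* b := b :+ con 1₅) refl (β 1))
    where open Q5-Solver
  ∑-binomial-β (suc (suc m)) = trans (cong₂ _⊕_ (β-rec m) (cong (λ c → ι c ⊗ β (suc (suc m))) (nCn≡1 (suc (suc m)))))
    (solve 1 (λ b → con 0₅ :+ con 1₅ :* b := b :+ con 0₅) refl (β (suc (suc m))))
    where open Q5-Solver

  homBernoulliTerm : ℕ → Q5 → Q5 → ℕ → Q5
  homBernoulliTerm n x d k = binomialTerm n x d k ⊗ β (n ∸ k)

  homBernoulli : ℕ → Q5 → Q5 → Q5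
  homBernoulli n x d = ∑ (suc n) (homBernoulliTerm n x d)

  private
    βTerm : ℕ → ℕ → ℕ → Q5
    βTerm n i u = ι ((n ∸ i) C u) ⊗ β u

    regroup-≤ : ∀ n x d k i → i ≤ k → k ≤ n →
      ι (n C k) ⊗ binomialTerm k x d i ⊗ pow5 d (n ∸ k) ⊗ β (n ∸ k) ≡ binomialTerm n x d i ⊗ βTerm n i (n ∸ k)
    regroup-≤ n x d k i i≤k k≤n = begin
      ι (n C k) ⊗ (ι (k C i) ⊗ pow5 x i ⊗ pow5 d (k ∸ i)) ⊗ pow5 d (n ∸ k) ⊗ β (n ∸ k)
        ≡⟨ solve 6 (λ a b c e f h → a :* (b :* c :* e) :* f :* h := (a :* b) :* c :* (e :* f) :* h) refl
             (ι (n C k)) (ι (k C i)) (pow5 x i) (pow5 d (k ∸ i)) (pow5 d (n ∸ k)) (β (n ∸ k)) ⟩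
      (ι (n C k) ⊗ ι (k C i)) ⊗ pow5 x i ⊗ (pow5 d (k ∸ i) ⊗ pow5 d (n ∸ k)) ⊗ β (n ∸ k)
        ≡⟨ cong₂ (λ c e → c ⊗ pow5 x i ⊗ e ⊗ β (n ∸ k)) coefficient power ⟩
      (ι (n C i) ⊗ ι ((n ∸ i) C (n ∸ k))) ⊗ pow5 x i ⊗ pow5 d (n ∸ i) ⊗ β (n ∸ k)
        ≡⟨ solve 5 (λ a b c e h → (a :* b) :* c :* e :* h := a :* c :* e :* (b :* h)) refl
             (ι (n C i)) (ι ((n ∸ i) C (n ∸ k))) (pow5 x i) (pow5 d (n ∸ i)) (β (n ∸ k)) ⟩
      binomialTerm n x d i ⊗ βTerm n i (n ∸ k) ∎
      where
      open ≡-Reasoning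
      open Q5-Solver
      coefficient : ι (n C k) ⊗ ι (k C i) ≡ ι (n C i) ⊗ ι ((n ∸ i) C (n ∸ k))
      coefficient = trans (sym (ι-* (n C k) (k C i)))
        (trans (cong ι (nCk*kCi≡nCi*[n∸i]C[n∸k] i≤k k≤n)) (ι-* (n C i) ((n ∸ i) C (n ∸ k))))
      [k∸i]+[n∸k]≡n∸i : (k ∸ i) + (n ∸ k) ≡ n ∸ i
      [k∸i]+[n∸k]≡n∸i = trans (+-comm (k ∸ i) (n ∸ k))
        (trans (sym (+-∸-assoc (n ∸ k) i≤k)) (cong (_∸ i) (m∸n+n≡m k≤n)))
      power : pow5 d (k ∸ i) ⊗ pow5 d (n ∸ k) ≡ pow5 d (n ∸ i)
      power = trans (sym (pow5-+ d (k ∸ i) (n ∸ k))) (cong (pow5 d) [k∸i]+[n∸k]≡n∸i)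
    regroup-> : ∀ n x d k i → k < i → i ≤ n →
      ι (n C k) ⊗ binomialTerm k x d i ⊗ pow5 d (n ∸ k) ⊗ β (n ∸ k) ≡ binomialTerm n x d i ⊗ βTerm n i (n ∸ k)
    regroup-> n x d k i k<i i≤n = begin
      ι (n C k) ⊗ binomialTerm k x d i ⊗ pow5 d (n ∸ k) ⊗ β (n ∸ k)
        ≡⟨ cong (λ t → ι (n C k) ⊗ t ⊗ pow5 d (n ∸ k) ⊗ β (n ∸ k)) (binomialTerm-≡0 k x d i k<i) ⟩
      ι (n C k) ⊗ 0₅ ⊗ pow5 d (n ∸ k) ⊗ β (n ∸ k)
        ≡⟨ solve 3 (λ a b c → a :* con 0₅ :* b :* c := con 0₅) refl (ι (n C k)) (pow5 d (n ∸ k)) (β (n ∸ k)) ⟩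
      0₅
        ≡⟨ solve 2 (λ p h → con 0₅ := p :* (con 0₅ :* h)) refl (binomialTerm n x d i) (β (n ∸ k)) ⟩
      binomialTerm n x d i ⊗ (ι 0 ⊗ β (n ∸ k))
        ≡⟨ cong (λ c → binomialTerm n x d i ⊗ (ι c ⊗ β (n ∸ k))) (sym (k>n⇒nCk≡0 (∸-monoʳ-< k<i i≤n))) ⟩
      binomialTerm n x d i ⊗ βTerm n i (n ∸ k) ∎
      where
      open ≡-Reasoning
      open Q5-Solver

    regroup : ∀ n x d k i → k ≤ n → i ≤ n →
      ι (n C k) ⊗ binomialTerm k x d i ⊗ pow5 d (n ∸ k) ⊗ β (n ∸ k) ≡ binomialTerm n x d i ⊗ βTerm n i (n ∸ k)
    regroup n x d k i k≤n i≤n =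
      [ (λ i≤k → regroup-≤ n x d k i i≤k k≤n) , (λ k<i → regroup-> n x d k i k<i i≤n) ]′ (≤-<-connex i k)

    expand : ∀ n x d k → k ≤ n →
      homBernoulliTerm n (x ⊕ d) d k ≡ ∑ (suc n) (λ i → binomialTerm n x d i ⊗ βTerm n i (n ∸ k))
    expand n x d k k≤n = begin
      ι (n C k) ⊗ pow5 (x ⊕ d) k ⊗ pow5 d (n ∸ k) ⊗ β (n ∸ k)
        ≡⟨ cong (λ t → ι (n C k) ⊗ t ⊗ pow5 d (n ∸ k) ⊗ β (n ∸ k)) (binomial-≤ n k x d k≤n) ⟩
      ι (n C k) ⊗ ∑ (suc n) (binomialTerm k x d) ⊗ pow5 d (n ∸ k) ⊗ β (n ∸ k)
        ≡⟨ cong (λ t → t ⊗ pow5 d (n ∸ k) ⊗ β (n ∸ k)) (∑-⊗ˡ (suc n) (ι (n C k)) _) ⟩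
      ∑ (suc n) (λ i → ι (n C k) ⊗ binomialTerm k x d i) ⊗ pow5 d (n ∸ k) ⊗ β (n ∸ k)
        ≡⟨ cong (_⊗ β (n ∸ k)) (∑-⊗ʳ (suc n) (pow5 d (n ∸ k)) _) ⟩
      ∑ (suc n) (λ i → ι (n C k) ⊗ binomialTerm k x d i ⊗ pow5 d (n ∸ k)) ⊗ β (n ∸ k)
        ≡⟨ ∑-⊗ʳ (suc n) (β (n ∸ k)) _ ⟩
      ∑ (suc n) (λ i → ι (n C k) ⊗ binomialTerm k x d i ⊗ pow5 d (n ∸ k) ⊗ β (n ∸ k))
        ≡⟨ ∑-cong-< (suc n) (λ i i<1+n → regroup n x d k i k≤n (≤-pred i<1+n)) ⟩
      ∑ (suc n) (λ i → binomialTerm n x d i ⊗ βTerm n i (n ∸ k)) ∎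
      where open ≡-Reasoning

    ∑-βTerm : ∀ n i → i ≤ n → ∑ (suc n) (λ k → βTerm n i (n ∸ k)) ≡ β (n ∸ i) ⊕ δ₁ (n ∸ i)
    ∑-βTerm n i i≤n = begin
      ∑ (suc n) (λ k → βTerm n i (n ∸ k))    ≡⟨ ∑-reverse n (βTerm n i) ⟩
      ∑ (suc n) (βTerm n i)                  ≡⟨ cong (λ z → ∑ z (βTerm n i)) (sym (trans (+-suc i (n ∸ i)) (cong suc (m+[n∸m]≡n i≤n)))) ⟩
      ∑ (i + suc (n ∸ i)) (βTerm n i)        ≡⟨ ∑-pad i (suc (n ∸ i)) (βTerm n i) βTerm≡0 ⟩
      ∑ (suc (n ∸ i)) (βTerm n i)            ≡⟨ ∑-binomial-β (n ∸ i) ⟩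
      β (n ∸ i) ⊕ δ₁ (n ∸ i)             ∎
      where
      open ≡-Reasoning
      βTerm≡0 : ∀ u → suc (n ∸ i) ≤ u → βTerm n i u ≡ 0₅
      βTerm≡0 u n∸i<u = trans (cong (λ c → ι c ⊗ β u) (k>n⇒nCk≡0 n∸i<u))
        (solve 1 (λ b → con 0₅ :* b := con 0₅) refl (β u))
        where open Q5-Solver

    ∑-δ₁ : ∀ m x d → ∑ (suc (suc m)) (λ i → binomialTerm (suc m) x d i ⊗ δ₁ (suc m ∸ i)) ≡ ι (suc m) ⊗ d ⊗ pow5 x m
    ∑-δ₁ m x d = begin
      ∑ m (λ i → P i ⊗ δ₁ (n ∸ i)) ⊕ P m ⊗ δ₁ (n ∸ m) ⊕ P n ⊗ δ₁ (n ∸ n)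
        ≡⟨ cong₂ (λ a b → a ⊕ P m ⊗ δ₁ (n ∸ m) ⊕ P n ⊗ δ₁ b)
             (∑-zero m (λ i i<m → trans (cong (P i ⊗_) (δ₁[1+m∸i]≡0 m i i<m)) (zeroʳ (P i)))) (n∸n≡0 n) ⟩
      0₅ ⊕ P m ⊗ δ₁ (n ∸ m) ⊕ P n ⊗ 0₅
        ≡⟨ cong (λ t → 0₅ ⊕ P m ⊗ δ₁ t ⊕ P n ⊗ 0₅) (m+n∸n≡m 1 m) ⟩
      0₅ ⊕ P m ⊗ 1₅ ⊕ P n ⊗ 0₅
        ≡⟨ solve 2 (λ a b → con 0₅ :+ a :* con 1₅ :+ b :* con 0₅ := a) refl (P m) (P n) ⟩
      ι (n C m) ⊗ pow5 x m ⊗ pow5 d (n ∸ m)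
        ≡⟨ cong₂ (λ c t → ι c ⊗ pow5 x m ⊗ pow5 d t) ([1+n]Cn≡1+n m) (m+n∸n≡m 1 m) ⟩
      ι n ⊗ pow5 x m ⊗ (d ⊗ 1₅)
        ≡⟨ solve 3 (λ a b c → a :* b :* (c :* con 1₅) := a :* c :* b) refl (ι n) (pow5 x m) d ⟩
      ι n ⊗ d ⊗ pow5 x m ∎
      where
      open ≡-Reasoning
      open Q5-Solver
      open CommutativeRing Q5-commutativeRing using (zeroʳ)
      n = suc m
      P = binomialTerm n x d
      δ₁[1+m∸i]≡0 : ∀ m i → i < m → δ₁ (suc m ∸ i) ≡ 0₅
      δ₁[1+m∸i]≡0 (suc m) zero    _         = refl
      δ₁[1+m∸i]≡0 (suc m) (suc i) (s≤s i<m) = δ₁[1+m∸i]≡0 m i i<m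

  homBernoulli-step : ∀ m x d → homBernoulli (suc m) (x ⊕ d) d ≡ homBernoulli (suc m) x d ⊕ ι (suc m) ⊗ d ⊗ pow5 x m
  homBernoulli-step m x d = begin
    ∑ (suc n) (homBernoulliTerm n (x ⊕ d) d)
      ≡⟨ ∑-cong-< (suc n) (λ k k<1+n → expand n x d k (≤-pred k<1+n)) ⟩
    ∑ (suc n) (λ k → ∑ (suc n) (λ i → P i ⊗ βTerm n i (n ∸ k)))
      ≡⟨ ∑-swap (suc n) (suc n) _ ⟩
    ∑ (suc n) (λ i → ∑ (suc n) (λ k → P i ⊗ βTerm n i (n ∸ k)))
      ≡⟨ ∑-cong-< (suc n) (λ i i<1+n → trans (sym (∑-⊗ˡ (suc n) (P i) _)) (cong (P i ⊗_) (∑-βTerm n i (≤-pred i<1+n)))) ⟩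
    ∑ (suc n) (λ i → P i ⊗ (β (n ∸ i) ⊕ δ₁ (n ∸ i)))
      ≡⟨ ∑-cong (suc n) (λ i → ⊗-distribˡ-⊕ (P i) (β (n ∸ i)) (δ₁ (n ∸ i))) ⟩
    ∑ (suc n) (λ i → P i ⊗ β (n ∸ i) ⊕ P i ⊗ δ₁ (n ∸ i))
      ≡⟨ ∑-⊕ (suc n) _ _ ⟩
    homBernoulli n x d ⊕ ∑ (suc n) (λ i → P i ⊗ δ₁ (n ∸ i))
      ≡⟨ cong (homBernoulli n x d ⊕_) (∑-δ₁ m x d) ⟩
    homBernoulli n x d ⊕ ι n ⊗ d ⊗ pow5 x m ∎
    where
    open ≡-Reasoning
    n = suc m
    P = binomialTerm n x d

  homBernoulli-shift : ∀ m x d N →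
    homBernoulli (suc m) (x ⊕ ι N ⊗ d) d ≡ homBernoulli (suc m) x d ⊕ ι (suc m) ⊗ d ⊗ ∑ N (λ i → pow5 (x ⊕ ι i ⊗ d) m)
  homBernoulli-shift m x d zero = trans (cong (λ y → homBernoulli (suc m) y d) (solve 2 (λ x d → x :+ con 0₅ :* d := x) refl x d))
    (solve 2 (λ h a → h := h :+ a :* con 0₅) refl (homBernoulli (suc m) x d) (ι (suc m) ⊗ d))
    where open Q5-Solver
  homBernoulli-shift m x d (suc N) = begin
    H (x ⊕ ι (suc N) ⊗ d) d
      ≡⟨ cong (λ y → H y d) (trans (cong (λ c → x ⊕ c ⊗ d) (ι-+ 1 N))
           (solve 3 (λ x c d → x :+ (con 1₅ :+ c) :* d := (x :+ c :* d) :+ d) refl x (ι N) d)) ⟩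
    H ((x ⊕ ι N ⊗ d) ⊕ d) d
      ≡⟨ homBernoulli-step m (x ⊕ ι N ⊗ d) d ⟩
    H (x ⊕ ι N ⊗ d) d ⊕ ι (suc m) ⊗ d ⊗ pow5 (x ⊕ ι N ⊗ d) m
      ≡⟨ cong (_⊕ ι (suc m) ⊗ d ⊗ pow5 (x ⊕ ι N ⊗ d) m) (homBernoulli-shift m x d N) ⟩
    H x d ⊕ ι (suc m) ⊗ d ⊗ S ⊕ ι (suc m) ⊗ d ⊗ pow5 (x ⊕ ι N ⊗ d) m
      ≡⟨ solve 4 (λ h a s t → h :+ a :* s :+ a :* t := h :+ a :* (s :+ t)) refl (H x d) (ι (suc m) ⊗ d) S (pow5 (x ⊕ ι N ⊗ d) m) ⟩
    H x d ⊕ ι (suc m) ⊗ d ⊗ ∑ (suc N) (λ i → pow5 (x ⊕ ι i ⊗ d) m) ∎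
    where
    open ≡-Reasoning
    open Q5-Solver
    H = homBernoulli (suc m)
    S = ∑ N (λ i → pow5 (x ⊕ ι i ⊗ d) m)

  homBernoulli-refine : ∀ m p x d e → ι (suc p) ⊗ e ≡ 1₅ →
    ι (suc p) ⊗ (homBernoulli (suc m) (x ⊕ d) (d ⊗ e) ⊝ homBernoulli (suc m) x (d ⊗ e))
      ⊝ (homBernoulli (suc m) (x ⊕ d) d ⊝ homBernoulli (suc m) x d)
    ≡ ι (suc m) ⊗ d ⊗ ∑ p (λ r → pow5 (x ⊕ ι (suc r) ⊗ (d ⊗ e)) m)
  -- x ⊕ d = x ⊕ q (d e): q steps of size d e against one step of size d, whose first terms cancel
  homBernoulli-refine m p x d e Qe≡1 = begin
    Q ⊗ (H (x ⊕ d) (d ⊗ e) ⊝ H x (d ⊗ e)) ⊝ (H (x ⊕ d) d ⊝ H x d)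
      ≡⟨ cong₂ (λ y z → Q ⊗ (H y (d ⊗ e) ⊝ H x (d ⊗ e)) ⊝ (z ⊝ H x d)) x⊕d≡x⊕Q⊗d′ (homBernoulli-step m x d) ⟩
    Q ⊗ (H (x ⊕ Q ⊗ (d ⊗ e)) (d ⊗ e) ⊝ H x (d ⊗ e)) ⊝ (H x d ⊕ c ⊗ d ⊗ a ⊝ H x d)
      ≡⟨ cong (λ y → Q ⊗ (y ⊝ H x (d ⊗ e)) ⊝ (H x d ⊕ c ⊗ d ⊗ a ⊝ H x d)) (homBernoulli-shift m x (d ⊗ e) (suc p)) ⟩
    Q ⊗ (H x (d ⊗ e) ⊕ c ⊗ (d ⊗ e) ⊗ ∑ (suc p) G ⊝ H x (d ⊗ e)) ⊝ (H x d ⊕ c ⊗ d ⊗ a ⊝ H x d)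
      ≡⟨ cong (λ y → Q ⊗ (H x (d ⊗ e) ⊕ c ⊗ (d ⊗ e) ⊗ y ⊝ H x (d ⊗ e)) ⊝ (H x d ⊕ c ⊗ d ⊗ a ⊝ H x d))
           (trans (∑-shift p G) (cong (_⊕ S) G0≡a)) ⟩
    Q ⊗ (H x (d ⊗ e) ⊕ c ⊗ (d ⊗ e) ⊗ (a ⊕ S) ⊝ H x (d ⊗ e)) ⊝ (H x d ⊕ c ⊗ d ⊗ a ⊝ H x d)
      ≡⟨ solve 8 (λ Q e h h′ c d a s → Q :* (h′ :+ c :* (d :* e) :* (a :+ s) :+ :- h′) :+ :- (h :+ c :* d :* a :+ :- h)
                  := c :* d :* s :+ (Q :* e :+ :- con 1₅) :* (c :* d :* (a :+ s))) refl
           Q e (H x d) (H x (d ⊗ e)) c d a S ⟩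
    c ⊗ d ⊗ S ⊕ (Q ⊗ e ⊝ 1₅) ⊗ (c ⊗ d ⊗ (a ⊕ S))
      ≡⟨ uv≡1⇒a⊕[uv⊝1]⊗b≡a Q e Qe≡1 (c ⊗ d ⊗ S) _ ⟩
    c ⊗ d ⊗ S ∎
    where
    open ≡-Reasoning
    open Q5-Solver
    H = homBernoulli (suc m)
    Q = ι (suc p)
    c = ι (suc m)
    G : ℕ → Q5
    G i = pow5 (x ⊕ ι i ⊗ (d ⊗ e)) m
    S = ∑ p (λ r → G (suc r))
    a = pow5 x m
    G0≡a : G 0 ≡ a
    G0≡a = cong (λ y → pow5 y m) (solve 2 (λ x d → x :+ con 0₅ :* d := x) refl x (d ⊗ e))
    x⊕d≡x⊕Q⊗d′ : x ⊕ d ≡ x ⊕ Q ⊗ (d ⊗ e)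
    x⊕d≡x⊕Q⊗d′ = sym (trans (solve 4 (λ x Q d e → x :+ Q :* (d :* e) := x :+ d :+ (Q :* e :+ :- con 1₅) :* d) refl x Q d e)
                              (uv≡1⇒a⊕[uv⊝1]⊗b≡a Q e Qe≡1 (x ⊕ d) d))

  homBernoulli-scaled-difference : ∀ n Q e x y d →
    ∑ (suc n) (λ k → ι (n C k) ⊗ (pow5 x k ⊝ pow5 y k) ⊗ pow5 d (n ∸ k) ⊗ ((Q ⊗ pow5 e (n ∸ k) ⊝ 1₅) ⊗ β (n ∸ k)))
    ≡ Q ⊗ (homBernoulli n x (d ⊗ e) ⊝ homBernoulli n y (d ⊗ e)) ⊝ (homBernoulli n x d ⊝ homBernoulli n y d)
  homBernoulli-scaled-difference n Q e x y d = begin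
    ∑ (suc n) (λ k → ι (n C k) ⊗ (pow5 x k ⊝ pow5 y k) ⊗ pow5 d (n ∸ k) ⊗ ((Q ⊗ pow5 e (n ∸ k) ⊝ 1₅) ⊗ β (n ∸ k)))
      ≡⟨ ∑-cong (suc n) split ⟩
    ∑ (suc n) (λ k → Q ⊗ (X k ⊝ Y k) ⊝ (Z k ⊝ W k))
      ≡⟨ ∑-⊝ (suc n) _ _ ⟩
    ∑ (suc n) (λ k → Q ⊗ (X k ⊝ Y k)) ⊝ ∑ (suc n) (λ k → Z k ⊝ W k)
      ≡⟨ cong₂ _⊝_ (sym (∑-⊗ˡ (suc n) Q _)) (∑-⊝ (suc n) Z W) ⟩
    Q ⊗ ∑ (suc n) (λ k → X k ⊝ Y k) ⊝ (∑ (suc n) Z ⊝ ∑ (suc n) W)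
      ≡⟨ cong (λ s → Q ⊗ s ⊝ (∑ (suc n) Z ⊝ ∑ (suc n) W)) (∑-⊝ (suc n) X Y) ⟩
    Q ⊗ (∑ (suc n) X ⊝ ∑ (suc n) Y) ⊝ (∑ (suc n) Z ⊝ ∑ (suc n) W) ∎
    where
    open ≡-Reasoning
    X Y Z W : ℕ → Q5
    X = homBernoulliTerm n x (d ⊗ e)
    Y = homBernoulliTerm n y (d ⊗ e)
    Z = homBernoulliTerm n x d
    W = homBernoulliTerm n y d
    split : ∀ k → ι (n C k) ⊗ (pow5 x k ⊝ pow5 y k) ⊗ pow5 d (n ∸ k) ⊗ ((Q ⊗ pow5 e (n ∸ k) ⊝ 1₅) ⊗ β (n ∸ k))
                ≡ Q ⊗ (X k ⊝ Y k) ⊝ (Z k ⊝ W k)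
    split k = trans
      (solve 7 (λ c a b dt Q et b′ → c :* (a :+ :- b) :* dt :* ((Q :* et :+ :- con 1₅) :* b′)
                 := Q :* (c :* a :* (dt :* et) :* b′ :+ :- (c :* b :* (dt :* et) :* b′)) :+ :- (c :* a :* dt :* b′ :+ :- (c :* b :* dt :* b′)))
         refl (ι (n C k)) (pow5 x k) (pow5 y k) (pow5 d (n ∸ k)) Q (pow5 e (n ∸ k)) (β (n ∸ k)))
      (cong (λ p → Q ⊗ (ι (n C k) ⊗ pow5 x k ⊗ p ⊗ β (n ∸ k) ⊝ ι (n C k) ⊗ pow5 y k ⊗ p ⊗ β (n ∸ k))
                     ⊝ (Z k ⊝ W k)) (sym (pow5-distrib-⊗ d e (n ∸ k))))
      where open Q5-Solver

length-bernList : ∀ m → length (bernList m) ≡ m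
length-bernList zero    = refl
length-bernList (suc m) = trans (length-++ (bernList m)) (trans (cong (_+ 1) (length-bernList m)) (+-comm m 1))

nth-++ˡ : ∀ xs ys k → k < length xs → nth (xs ++ ys) k ≡ nth xs k
nth-++ˡ (x ∷ xs) ys zero    _         = refl
nth-++ˡ (x ∷ xs) ys (suc k) (s≤s k<n) = nth-++ˡ xs ys k k<n

nth-++-length : ∀ xs y → nth (xs ++ y ∷ []) (length xs) ≡ y
nth-++-length []       y = refl
nth-++-length (x ∷ xs) y = nth-++-length xs y

nth-bernList : ∀ m k → k < m → nth (bernList m) k ≡ bernoulli k
nth-bernList (suc m) k (s≤s k≤m) with m≤n⇒m<n∨m≡n k≤m
... | inj₁ k<m  = trans (nth-++ˡ (bernList m) _ k (subst (k <_) (sym (length-bernList m)) k<m)) (nth-bernList m k k<m)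
... | inj₂ refl = refl

bernoulli-suc : ∀ m → bernoulli (suc m) ≡ bernNext (suc m) (bernList (suc m))
bernoulli-suc m = trans (cong (nth (bernList (suc m) ++ bernNext (suc m) (bernList (suc m)) ∷ [])) (sym (length-bernList (suc m))))
  (nth-++-length (bernList (suc m)) _)

embed-sumFromTo : ∀ m g → embed (sumFromTo 0 m g) ≡ ∑ (suc m) (λ k → embed (g k))
embed-sumFromTo zero    g = refl
embed-sumFromTo (suc m) g = cong (_⊕ embed (g (suc m))) (embed-sumFromTo m g)

ℕ→ℚ[1+n]*1/[1+n]≡1 : ∀ n → ℕ→ℚ (suc n) ℚ.* (+ 1 ℚ./ suc n) ≡ 1ℚ
ℕ→ℚ[1+n]*1/[1+n]≡1 n =
  trans (cong₂ ℚ._*_ (ℚP.normalize-coprime (Coprime.sym (Coprime.1-coprimeTo (suc n))))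
                     (ℚP.normalize-coprime {1} {n} (Coprime.1-coprimeTo (suc n))))
        (ℚP.*-inverseʳ (mkℚ (+ suc n) 0 (Coprime.sym (Coprime.1-coprimeTo (suc n)))))

bernoulli-recurrence : ∀ m → ∑ (suc (suc m)) (λ k → ι (suc (suc m) C k) ⊗ embed (bernoulli k)) ≡ 0₅
bernoulli-recurrence m = begin
  ∑ (suc m) (λ k → ι (N C k) ⊗ embed (bernoulli k)) ⊕ ι (N C suc m) ⊗ embed (bernoulli (suc m))
    ≡⟨ cong₂ _⊕_ (∑-cong-< (suc m) (λ k k<1+m → trans (cong (λ b → ι (N C k) ⊗ embed b) (sym (nth-bernList (suc m) k k<1+m)))
                                                        (sym (embed-* (ℕ→ℚ (N C k)) _))))
                 (cong₂ (λ c b → ι c ⊗ embed b) ([1+n]Cn≡1+n (suc m)) (bernoulli-suc m)) ⟩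
  ∑ (suc m) (λ k → embed (g k)) ⊕ ι N ⊗ embed (ℚ.- (h ℚ.* S))
    ≡⟨ cong₂ _⊕_ (sym (embed-sumFromTo m g)) (sym (embed-* (ℕ→ℚ N) (ℚ.- (h ℚ.* S)))) ⟩
  embed (S ℚ.+ ℕ→ℚ N ℚ.* ℚ.- (h ℚ.* S))
    ≡⟨ cong embed (trans (solve 3 (λ s n h → s :+ n :* (:- (h :* s)) := s :- (n :* h) :* s) refl S (ℕ→ℚ N) h)
                    (trans (cong (λ z → S ℚ.+ ℚ.- (z ℚ.* S)) (ℕ→ℚ[1+n]*1/[1+n]≡1 (suc m)))
                      (solve 1 (λ s → s :- con 1ℚ :* s := con 0ℚ) refl S))) ⟩
  0₅ ∎
  where
  open ≡-Reasoning
  open ℚ-Solver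
  N = suc (suc m)
  h = + 1 ℚ./ N
  g : ℕ → ℚ
  g k = ℕ→ℚ (N C k) ℚ.* nth (bernList (suc m)) k
  S = sumFromTo 0 m g

-- Powers of L_j ± √5 F_j

ι[2*lucas[m+n]] : ∀ m n → ι 2 ⊗ ι (lucas (m + n)) ≡ ι (lucas m) ⊗ ι (lucas n) ⊕ ι 5 ⊗ ι (fib m) ⊗ ι (fib n)
ι[2*lucas[m+n]] m n = begin
  ι 2 ⊗ ι (lucas (m + n))                             ≡⟨ sym (ι-* 2 (lucas (m + n))) ⟩
  ι (2 * lucas (m + n))                               ≡⟨ cong ι (2*lucas[m+n]≡lucas*lucas+5*fib*fib m n) ⟩
  ι (lucas m * lucas n + 5 * fib m * fib n)           ≡⟨ ι-+ (lucas m * lucas n) (5 * fib m * fib n) ⟩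
  ι (lucas m * lucas n) ⊕ ι (5 * fib m * fib n)       ≡⟨ cong₂ _⊕_ (ι-* (lucas m) (lucas n)) (trans (ι-* (5 * fib m) (fib n)) (cong (_⊗ ι (fib n)) (ι-* 5 (fib m)))) ⟩
  ι (lucas m) ⊗ ι (lucas n) ⊕ ι 5 ⊗ ι (fib m) ⊗ ι (fib n) ∎
  where open ≡-Reasoning

ι[2*fib[m+n]] : ∀ m n → ι 2 ⊗ ι (fib (m + n)) ≡ ι (lucas m) ⊗ ι (fib n) ⊕ ι (fib m) ⊗ ι (lucas n)
ι[2*fib[m+n]] m n = begin
  ι 2 ⊗ ι (fib (m + n))                               ≡⟨ sym (ι-* 2 (fib (m + n))) ⟩
  ι (2 * fib (m + n))                                 ≡⟨ cong ι (2*fib[m+n]≡lucas*fib+fib*lucas m n) ⟩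
  ι (lucas m * fib n + fib m * lucas n)               ≡⟨ ι-+ (lucas m * fib n) (fib m * lucas n) ⟩
  ι (lucas m * fib n) ⊕ ι (fib m * lucas n)           ≡⟨ cong₂ _⊕_ (ι-* (lucas m) (fib n)) (ι-* (fib m) (lucas n)) ⟩
  ι (lucas m) ⊗ ι (fib n) ⊕ ι (fib m) ⊗ ι (lucas n)   ∎
  where open ≡-Reasoning

lucasFib : Q5 → ℕ → Q5
lucasFib E i = ι (lucas i) ⊕ E ⊗ ι (fib i)

2⊗lucasFib^k : ∀ E → E ⊗ E ≡ ι 5 → ∀ j k → ι 2 ⊗ pow5 (lucasFib E j) k ≡ pow5 (ι 2) k ⊗ lucasFib E (j * k)
2⊗lucasFib^k E E²≡5 j zero = trans
  (solve 1 (λ E → con (ι 2) :* con 1₅ := con 1₅ :* (con (ι 2) :+ E :* con 0₅)) refl E)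
  (cong (λ i → 1₅ ⊗ (ι (lucas i) ⊕ E ⊗ ι (fib i))) (sym (*-zeroʳ j)))
  where open Q5-Solver
2⊗lucasFib^k E E²≡5 j (suc k) = begin
  ι 2 ⊗ (α ⊗ pow5 α k)                              ≡⟨ solve 3 (λ t a p → t :* (a :* p) := a :* (t :* p)) refl (ι 2) α (pow5 α k) ⟩
  α ⊗ (ι 2 ⊗ pow5 α k)                              ≡⟨ cong (α ⊗_) (2⊗lucasFib^k E E²≡5 j k) ⟩
  α ⊗ (pow5 (ι 2) k ⊗ (ι L′ ⊕ E ⊗ ι F′))
    ≡⟨ solve 6 (λ t L F E L′ F′ → (L :+ E :* F) :* (t :* (L′ :+ E :* F′))
                 := t :* ((L :* L′ :+ E :* E :* F :* F′) :+ E :* (L :* F′ :+ F :* L′))) refl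
         (pow5 (ι 2) k) (ι (lucas j)) (ι (fib j)) E (ι L′) (ι F′) ⟩
  pow5 (ι 2) k ⊗ ((ι (lucas j) ⊗ ι L′ ⊕ E ⊗ E ⊗ ι (fib j) ⊗ ι F′) ⊕ E ⊗ (ι (lucas j) ⊗ ι F′ ⊕ ι (fib j) ⊗ ι L′))
    ≡⟨ cong₂ (λ l f → pow5 (ι 2) k ⊗ (l ⊕ E ⊗ f))
         (trans (cong (λ e → ι (lucas j) ⊗ ι L′ ⊕ e ⊗ ι (fib j) ⊗ ι F′) E²≡5) (sym (ι[2*lucas[m+n]] j (j * k))))
         (sym (ι[2*fib[m+n]] j (j * k))) ⟩
  pow5 (ι 2) k ⊗ (ι 2 ⊗ ι (lucas (j + j * k)) ⊕ E ⊗ (ι 2 ⊗ ι (fib (j + j * k))))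
    ≡⟨ solve 5 (λ p t L F E → p :* (t :* L :+ E :* (t :* F)) := t :* p :* (L :+ E :* F)) refl
         (pow5 (ι 2) k) (ι 2) (ι (lucas (j + j * k))) (ι (fib (j + j * k))) E ⟩
  pow5 (ι 2) (suc k) ⊗ (ι (lucas (j + j * k)) ⊕ E ⊗ ι (fib (j + j * k)))
    ≡⟨ cong (λ i → pow5 (ι 2) (suc k) ⊗ (ι (lucas i) ⊕ E ⊗ ι (fib i))) (sym (*-suc j k)) ⟩
  pow5 (ι 2) (suc k) ⊗ (ι (lucas (j * suc k)) ⊕ E ⊗ ι (fib (j * suc k))) ∎
  where
  open ≡-Reasoning
  open Q5-Solver
  α = lucasFib E j
  L′ = lucas (j * k)
  F′ = fib (j * k)

lucasFib^k-difference : ∀ E → E ⊗ E ≡ ι 5 → ∀ j k →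
  pow5 (lucasFib E j) k ⊝ pow5 (lucasFib (⊖ E) j) k ≡ pow5 (ι 2) k ⊗ ι (fib (j * k)) ⊗ E
lucasFib^k-difference E E²≡5 j k = begin
  a ⊝ b
    ≡⟨ sym (uv≡1⇒a⊕[uv⊝1]⊗b≡a ½ (ι 2) refl (a ⊝ b) (a ⊝ b)) ⟩
  (a ⊝ b) ⊕ (½ ⊗ ι 2 ⊝ 1₅) ⊗ (a ⊝ b)
    ≡⟨ solve 4 (λ a b h t → (a :+ :- b) :+ (h :* t :+ :- con 1₅) :* (a :+ :- b) := h :* (t :* a :+ :- (t :* b))) refl a b ½ (ι 2) ⟩
  ½ ⊗ (ι 2 ⊗ a ⊝ ι 2 ⊗ b)
    ≡⟨ cong₂ (λ u v → ½ ⊗ (u ⊝ v)) (2⊗lucasFib^k E E²≡5 j k) (2⊗lucasFib^k (⊖ E) ⊖E²≡5 j k) ⟩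
  ½ ⊗ (P ⊗ lucasFib E (j * k) ⊝ P ⊗ lucasFib (⊖ E) (j * k))
    ≡⟨ solve 5 (λ h P L F E → h :* (P :* (L :+ E :* F) :+ :- (P :* (L :+ :- E :* F)))
                 := P :* F :* E :+ (h :* con (ι 2) :+ :- con 1₅) :* (P :* F :* E)) refl
         ½ P (ι (lucas (j * k))) (ι (fib (j * k))) E ⟩
  P ⊗ ι (fib (j * k)) ⊗ E ⊕ (½ ⊗ ι 2 ⊝ 1₅) ⊗ (P ⊗ ι (fib (j * k)) ⊗ E)
    ≡⟨ uv≡1⇒a⊕[uv⊝1]⊗b≡a ½ (ι 2) refl (P ⊗ ι (fib (j * k)) ⊗ E) (P ⊗ ι (fib (j * k)) ⊗ E) ⟩
  P ⊗ ι (fib (j * k)) ⊗ E ∎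
  where
  open ≡-Reasoning
  open Q5-Solver
  a = pow5 (lucasFib E j) k
  b = pow5 (lucasFib (⊖ E) j) k
  P = pow5 (ι 2) k
  ½ = embed (+ 1 ℚ./ 2)
  ⊖E²≡5 : ⊖ E ⊗ ⊖ E ≡ ι 5
  ⊖E²≡5 = trans (solve 1 (λ E → :- E :* :- E := E :* E) refl E) E²≡5

inv-unique : ∀ x y → x ℚ.* y ≡ 1ℚ → inv x ≡ y
inv-unique x y xy≡1 with x ℚP.≟ 0ℚ
... | yes refl = ⊥-elim (0≢1 (trans (sym (ℚP.*-zeroˡ y)) xy≡1))
  where
  0≢1 : ¬ 0ℚ ≡ 1ℚ
  0≢1 ()
... | no x≢0 = begin
  ℚ.1/ x                  ≡⟨ sym (ℚP.*-identityʳ (ℚ.1/ x)) ⟩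
  ℚ.1/ x ℚ.* 1ℚ           ≡⟨ cong (ℚ.1/ x ℚ.*_) (sym xy≡1) ⟩
  ℚ.1/ x ℚ.* (x ℚ.* y)    ≡⟨ sym (ℚP.*-assoc (ℚ.1/ x) x y) ⟩
  ℚ.1/ x ℚ.* x ℚ.* y      ≡⟨ cong (ℚ._* y) (ℚP.*-inverseˡ x) ⟩
  1ℚ ℚ.* y                ≡⟨ ℚP.*-identityˡ y ⟩
  y                       ∎
  where
  open ≡-Reasoning
  instance _ = ℚ.≢-nonZero x≢0

ℕ→ℚ[1+n]*inv≡1 : ∀ n → ℕ→ℚ (suc n) ℚ.* inv (ℕ→ℚ (suc n)) ≡ 1ℚ
ℕ→ℚ[1+n]*inv≡1 n = trans (cong (ℕ→ℚ (suc n) ℚ.*_) (inv-unique (ℕ→ℚ (suc n)) (+ 1 ℚ./ suc n) (ℕ→ℚ[1+n]*1/[1+n]≡1 n))) (ℕ→ℚ[1+n]*1/[1+n]≡1 n)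

powℕ-inverse : ∀ x y → x ℚ.* y ≡ 1ℚ → ∀ k → powℕ x k ℚ.* powℕ y k ≡ 1ℚ
powℕ-inverse x y xy≡1 zero    = refl
powℕ-inverse x y xy≡1 (suc k) = begin
  x ℚ.* powℕ x k ℚ.* (y ℚ.* powℕ y k)       ≡⟨ solve 4 (λ x a y b → x :* a :* (y :* b) := x :* y :* (a :* b)) refl x (powℕ x k) y (powℕ y k) ⟩
  x ℚ.* y ℚ.* (powℕ x k ℚ.* powℕ y k)       ≡⟨ cong₂ ℚ._*_ xy≡1 (powℕ-inverse x y xy≡1 k) ⟩
  1ℚ                                        ∎
  where
  open ≡-Reasoning
  open ℚ-Solver

powℤ[1-t] : ∀ x y → x ℚ.* y ≡ 1ℚ → ∀ t → powℤ x (+ 1 ℤ.- + t) ≡ x ℚ.* powℕ y t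
powℤ[1-t] x y xy≡1 zero          = refl
powℤ[1-t] x y xy≡1 (suc zero)    = sym (trans (cong (x ℚ.*_) (ℚP.*-identityʳ y)) xy≡1)
powℤ[1-t] x y xy≡1 (suc (suc t)) = begin
  inv (powℕ x (suc t))                 ≡⟨ inv-unique (powℕ x (suc t)) (powℕ y (suc t)) (powℕ-inverse x y xy≡1 (suc t)) ⟩
  powℕ y (suc t)                       ≡⟨ sym (ℚP.*-identityˡ _) ⟩
  1ℚ ℚ.* powℕ y (suc t)                ≡⟨ cong (ℚ._* powℕ y (suc t)) (sym xy≡1) ⟩
  x ℚ.* y ℚ.* powℕ y (suc t)           ≡⟨ ℚP.*-assoc x y _ ⟩
  x ℚ.* (y ℚ.* powℕ y (suc t))         ∎
  where open ≡-Reasoning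

⊗-cancelˡ : ∀ u v {x y} → v ⊗ u ≡ 1₅ → u ⊗ x ≡ u ⊗ y → x ≡ y
⊗-cancelˡ u v {x} {y} vu≡1 ux≡uy = begin
  x              ≡⟨ sym (trans (cong (_⊗ x) vu≡1) (⊗-identityˡ x)) ⟩
  v ⊗ u ⊗ x      ≡⟨ ⊗-assoc v u x ⟩
  v ⊗ (u ⊗ x)    ≡⟨ cong (v ⊗_) ux≡uy ⟩
  v ⊗ (u ⊗ y)    ≡⟨ sym (⊗-assoc v u y) ⟩
  v ⊗ u ⊗ y      ≡⟨ trans (cong (_⊗ y) vu≡1) (⊗-identityˡ y) ⟩
  y              ∎
  where open ≡-Reasoning

±√5 : Sign → Q5
±√5 s = embed (signℚ s) ⊗ √5

±√5⊗±√5≡5 : ∀ s → ±√5 s ⊗ ±√5 s ≡ ι 5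
±√5⊗±√5≡5 Sign.+ = refl
±√5⊗±√5≡5 Sign.- = refl

±√5/5⊗±√5≡1 : ∀ s → embed (+ 1 ℚ./ 5) ⊗ ±√5 s ⊗ ±√5 s ≡ 1₅
±√5/5⊗±√5≡1 Sign.+ = refl
±√5/5⊗±√5≡1 Sign.- = refl

open HomogeneousBernoulli (λ k → embed (bernoulli k)) refl bernoulli-recurrence

module Corollary20 (s : Sign) (m j p : ℕ) where

  private
    n q : ℕ
    n = suc m
    q = suc p
    E D L Q e : Q5
    E = ±√5 s
    D = s5F s j
    L = ι (lucas j)
    Q = ι q
    e = embed (inv (ℕ→ℚ q))

  Q⊗e≡1 : Q ⊗ e ≡ 1₅
  Q⊗e≡1 = trans (sym (embed-* (ℕ→ℚ q) (inv (ℕ→ℚ q)))) (cong embed (ℕ→ℚ[1+n]*inv≡1 p))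

  D≡E⊗F : D ≡ E ⊗ ι (fib j)
  D≡E⊗F = trans (cong (_⊗ √5) (embed-* (signℚ s) (ℕ→ℚ (fib j))))
    (solve 3 (λ σ F r → σ :* F :* r := σ :* r :* F) refl (embed (signℚ s)) (ι (fib j)) √5)
    where open Q5-Solver

  L⊕D≡lucasFib : L ⊕ D ≡ lucasFib E j
  L⊕D≡lucasFib = cong (L ⊕_) D≡E⊗F

  L⊝D≡lucasFib : L ⊝ D ≡ lucasFib (⊖ E) j
  L⊝D≡lucasFib = trans (cong (L ⊝_) D≡E⊗F) (solve 3 (λ L E F → L :+ :- (E :* F) := L :+ :- E :* F) refl L E (ι (fib j)))
    where open Q5-Solver

  E⊗lhs-term : ∀ k →
    E ⊗ (embed (ℕ→ℚ (n C k) ℚ.* powℕ (ℕ→ℚ 2) k ℚ.* ℕ→ℚ (fib (j * k))) ⊗ pow5 D (n ∸ k)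
         ⊗ embed ((powℤ (ℕ→ℚ q) (+ 1 ℤ.- + (n ∸ k)) ℚ.- 1ℚ) ℚ.* bernoulli (n ∸ k)))
    ≡ ι (n C k) ⊗ (pow5 (L ⊕ D) k ⊝ pow5 (L ⊝ D) k) ⊗ pow5 D (n ∸ k) ⊗ ((Q ⊗ pow5 e (n ∸ k) ⊝ 1₅) ⊗ embed (bernoulli (n ∸ k)))
  E⊗lhs-term k = begin
    E ⊗ (embed (ℕ→ℚ (n C k) ℚ.* powℕ (ℕ→ℚ 2) k ℚ.* ℕ→ℚ (fib (j * k))) ⊗ pow5 D t ⊗ embed ((powℤ (ℕ→ℚ q) (+ 1 ℤ.- + t) ℚ.- 1ℚ) ℚ.* b))
      ≡⟨ cong₂ (λ c B → E ⊗ (c ⊗ pow5 D t ⊗ B)) coefficient bernoulliFactor ⟩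
    E ⊗ (ι (n C k) ⊗ P ⊗ ι (fib (j * k)) ⊗ pow5 D t ⊗ B)
      ≡⟨ solve 6 (λ E c P F d B → E :* (c :* P :* F :* d :* B) := c :* (P :* F :* E) :* d :* B) refl
           E (ι (n C k)) P (ι (fib (j * k))) (pow5 D t) B ⟩
    ι (n C k) ⊗ (P ⊗ ι (fib (j * k)) ⊗ E) ⊗ pow5 D t ⊗ B
      ≡⟨ cong (λ z → ι (n C k) ⊗ z ⊗ pow5 D t ⊗ B) (sym difference) ⟩
    ι (n C k) ⊗ (pow5 (L ⊕ D) k ⊝ pow5 (L ⊝ D) k) ⊗ pow5 D t ⊗ B ∎
    where
    open ≡-Reasoning
    open Q5-Solver
    t = n ∸ k
    b = bernoulli t
    P = pow5 (ι 2) k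
    B = (Q ⊗ pow5 e t ⊝ 1₅) ⊗ embed b
    coefficient : embed (ℕ→ℚ (n C k) ℚ.* powℕ (ℕ→ℚ 2) k ℚ.* ℕ→ℚ (fib (j * k))) ≡ ι (n C k) ⊗ P ⊗ ι (fib (j * k))
    coefficient = trans (embed-* (ℕ→ℚ (n C k) ℚ.* powℕ (ℕ→ℚ 2) k) (ℕ→ℚ (fib (j * k))))
      (cong (_⊗ ι (fib (j * k))) (trans (embed-* (ℕ→ℚ (n C k)) (powℕ (ℕ→ℚ 2) k)) (cong (ι (n C k) ⊗_) (embed-pow (ℕ→ℚ 2) k))))
    bernoulliFactor : embed ((powℤ (ℕ→ℚ q) (+ 1 ℤ.- + t) ℚ.- 1ℚ) ℚ.* b) ≡ B
    bernoulliFactor = trans (embed-* (powℤ (ℕ→ℚ q) (+ 1 ℤ.- + t) ℚ.- 1ℚ) b)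
      (cong (λ z → (z ⊝ 1₅) ⊗ embed b)
        (trans (cong embed (powℤ[1-t] (ℕ→ℚ q) (inv (ℕ→ℚ q)) (ℕ→ℚ[1+n]*inv≡1 p) t))
          (trans (embed-* (ℕ→ℚ q) _) (cong (Q ⊗_) (embed-pow (inv (ℕ→ℚ q)) t)))))
    difference : pow5 (L ⊕ D) k ⊝ pow5 (L ⊝ D) k ≡ P ⊗ ι (fib (j * k)) ⊗ E
    difference = trans (cong₂ (λ a a′ → pow5 a k ⊝ pow5 a′ k) L⊕D≡lucasFib L⊝D≡lucasFib)
                       (lucasFib^k-difference E (±√5⊗±√5≡5 s) j k)

  S : Q5 → Q5
  S x = ∑ p (λ r → pow5 (x ⊕ ι (suc r) ⊗ (D ⊗ e)) m)

  E⊗lhs : E ⊗ lhs s n j q ≡ ι n ⊗ D ⊗ (S L ⊕ S (L ⊝ D))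
  E⊗lhs = begin
    E ⊗ lhs s n j q
      ≡⟨ trans (cong (E ⊗_) (sum5-0≡∑ n _)) (trans (∑-⊗ˡ (suc n) E _) (∑-cong (suc n) E⊗lhs-term)) ⟩
    ∑ (suc n) (λ k → ι (n C k) ⊗ (pow5 (L ⊕ D) k ⊝ pow5 (L ⊝ D) k) ⊗ pow5 D (n ∸ k) ⊗ ((Q ⊗ pow5 e (n ∸ k) ⊝ 1₅) ⊗ embed (bernoulli (n ∸ k))))
      ≡⟨ homBernoulli-scaled-difference n Q e (L ⊕ D) (L ⊝ D) D ⟩
    Q ⊗ (H (L ⊕ D) (D ⊗ e) ⊝ H (L ⊝ D) (D ⊗ e)) ⊝ (H (L ⊕ D) D ⊝ H (L ⊝ D) D)
      ≡⟨ solve 7 (λ Q a b c a′ b′ c′ → Q :* (a :+ :- c) :+ :- (a′ :+ :- c′)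
                  := (Q :* (a :+ :- b) :+ :- (a′ :+ :- b′)) :+ (Q :* (b :+ :- c) :+ :- (b′ :+ :- c′))) refl
           Q (H (L ⊕ D) (D ⊗ e)) (H L (D ⊗ e)) (H (L ⊝ D) (D ⊗ e)) (H (L ⊕ D) D) (H L D) (H (L ⊝ D) D) ⟩
    Δ L ⊕ (Q ⊗ (H L (D ⊗ e) ⊝ H (L ⊝ D) (D ⊗ e)) ⊝ (H L D ⊝ H (L ⊝ D) D))
      ≡⟨ cong (λ y → Δ L ⊕ (Q ⊗ (H y (D ⊗ e) ⊝ H (L ⊝ D) (D ⊗ e)) ⊝ (H y D ⊝ H (L ⊝ D) D))) L≡[L⊝D]⊕D ⟩
    Δ L ⊕ Δ (L ⊝ D)
      ≡⟨ cong₂ _⊕_ (homBernoulli-refine m p L D e Q⊗e≡1) (homBernoulli-refine m p (L ⊝ D) D e Q⊗e≡1) ⟩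
    ι n ⊗ D ⊗ S L ⊕ ι n ⊗ D ⊗ S (L ⊝ D)
      ≡⟨ sym (⊗-distribˡ-⊕ (ι n ⊗ D) (S L) (S (L ⊝ D))) ⟩
    ι n ⊗ D ⊗ (S L ⊕ S (L ⊝ D)) ∎
    where
    open ≡-Reasoning
    open Q5-Solver
    H = homBernoulli n
    Δ : Q5 → Q5
    Δ x = Q ⊗ (H (x ⊕ D) (D ⊗ e) ⊝ H x (D ⊗ e)) ⊝ (H (x ⊕ D) D ⊝ H x D)
    L≡[L⊝D]⊕D : L ≡ L ⊝ D ⊕ D
    L≡[L⊝D]⊕D = solve 2 (λ L D → L := L :+ :- D :+ D) refl L D

  E⊗rhs-coefficient : E ⊗ embed (ℕ→ℚ n ℚ.* ℕ→ℚ (fib j) ℚ.* powℤ (ℕ→ℚ q) (+ 1 ℤ.- + n)) ≡ ι n ⊗ D ⊗ pow5 e m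
  E⊗rhs-coefficient = begin
    E ⊗ embed (ℕ→ℚ n ℚ.* ℕ→ℚ (fib j) ℚ.* powℤ (ℕ→ℚ q) (+ 1 ℤ.- + n))
      ≡⟨ cong (λ z → E ⊗ embed (ℕ→ℚ n ℚ.* ℕ→ℚ (fib j) ℚ.* z)) (powℤ[1-t] (ℕ→ℚ q) (inv (ℕ→ℚ q)) (ℕ→ℚ[1+n]*inv≡1 p) n) ⟩
    E ⊗ embed (ℕ→ℚ n ℚ.* ℕ→ℚ (fib j) ℚ.* (ℕ→ℚ q ℚ.* powℕ (inv (ℕ→ℚ q)) n))
      ≡⟨ cong (E ⊗_) (trans (embed-* (ℕ→ℚ n ℚ.* ℕ→ℚ (fib j)) _)
           (cong₂ _⊗_ (embed-* (ℕ→ℚ n) (ℕ→ℚ (fib j))) (trans (embed-* (ℕ→ℚ q) _) (cong (Q ⊗_) (embed-pow (inv (ℕ→ℚ q)) n))))) ⟩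
    E ⊗ (ι n ⊗ ι (fib j) ⊗ (Q ⊗ (e ⊗ pow5 e m)))
      ≡⟨ solve 6 (λ E c F Q e eᵐ → E :* (c :* F :* (Q :* (e :* eᵐ))) := c :* (E :* F) :* eᵐ :+ (Q :* e :+ :- con 1₅) :* (c :* (E :* F) :* eᵐ))
           refl E (ι n) (ι (fib j)) Q e (pow5 e m) ⟩
    ι n ⊗ (E ⊗ ι (fib j)) ⊗ pow5 e m ⊕ (Q ⊗ e ⊝ 1₅) ⊗ (ι n ⊗ (E ⊗ ι (fib j)) ⊗ pow5 e m)
      ≡⟨ uv≡1⇒a⊕[uv⊝1]⊗b≡a Q e Q⊗e≡1 _ _ ⟩
    ι n ⊗ (E ⊗ ι (fib j)) ⊗ pow5 e m
      ≡⟨ cong (λ d → ι n ⊗ d ⊗ pow5 e m) (sym D≡E⊗F) ⟩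
    ι n ⊗ D ⊗ pow5 e m ∎
    where
    open ≡-Reasoning
    open Q5-Solver

  e⊗[D⊗r⊕Q⊗L] : ∀ r → e ⊗ (D ⊗ ι r ⊕ Q ⊗ L) ≡ L ⊕ ι r ⊗ (D ⊗ e)
  e⊗[D⊗r⊕Q⊗L] r = trans
    (solve 5 (λ e D c Q L → e :* (D :* c :+ Q :* L) := L :+ c :* (D :* e) :+ (Q :* e :+ :- con 1₅) :* L) refl e D (ι r) Q L)
    (uv≡1⇒a⊕[uv⊝1]⊗b≡a Q e Q⊗e≡1 (L ⊕ ι r ⊗ (D ⊗ e)) L)
    where open Q5-Solver

  e⊗[D⊗[r⊝q]⊕Q⊗L] : ∀ r → e ⊗ (D ⊗ (ι r ⊝ Q) ⊕ Q ⊗ L) ≡ L ⊝ D ⊕ ι r ⊗ (D ⊗ e)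
  e⊗[D⊗[r⊝q]⊕Q⊗L] r = trans
    (solve 5 (λ e D c Q L → e :* (D :* (c :+ :- Q) :+ Q :* L) := L :+ :- D :+ c :* (D :* e) :+ (Q :* e :+ :- con 1₅) :* (L :+ :- D))
       refl e D (ι r) Q L)
    (uv≡1⇒a⊕[uv⊝1]⊗b≡a Q e Q⊗e≡1 (L ⊝ D ⊕ ι r ⊗ (D ⊗ e)) (L ⊝ D))
    where open Q5-Solver

  E⊗rhs : E ⊗ rhs s n j q ≡ ι n ⊗ D ⊗ (S L ⊕ S (L ⊝ D))
  E⊗rhs = begin
    E ⊗ (K ⊗ sum5 1 p Y)
      ≡⟨ trans (sym (⊗-assoc E K _)) (cong₂ _⊗_ E⊗rhs-coefficient (sum5-1≡∑ p Y)) ⟩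
    ι n ⊗ D ⊗ pow5 e m ⊗ ∑ p (λ r → Y (suc r))
      ≡⟨ trans (⊗-assoc (ι n ⊗ D) (pow5 e m) _) (cong (ι n ⊗ D ⊗_) (∑-⊗ˡ p (pow5 e m) _)) ⟩
    ι n ⊗ D ⊗ ∑ p (λ r → pow5 e m ⊗ Y (suc r))
      ≡⟨ cong (ι n ⊗ D ⊗_) (trans (∑-cong p scale) (∑-⊕ p _ _)) ⟩
    ι n ⊗ D ⊗ (S L ⊕ S (L ⊝ D)) ∎
    where
    open ≡-Reasoning
    K = embed (ℕ→ℚ n ℚ.* ℕ→ℚ (fib j) ℚ.* powℤ (ℕ→ℚ q) (+ 1 ℤ.- + n))
    Y : ℕ → Q5
    Y r = pow5 (D ⊗ ι r ⊕ embed (ℕ→ℚ q ℚ.* ℕ→ℚ (lucas j))) m ⊕ pow5 (D ⊗ (ι r ⊝ Q) ⊕ embed (ℕ→ℚ q ℚ.* ℕ→ℚ (lucas j))) m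
    scale : ∀ r → pow5 e m ⊗ Y (suc r) ≡ pow5 (L ⊕ ι (suc r) ⊗ (D ⊗ e)) m ⊕ pow5 (L ⊝ D ⊕ ι (suc r) ⊗ (D ⊗ e)) m
    scale r = begin
      pow5 e m ⊗ Y (suc r)
        ≡⟨ ⊗-distribˡ-⊕ (pow5 e m) _ _ ⟩
      pow5 e m ⊗ pow5 (D ⊗ ι (suc r) ⊕ QL) m ⊕ pow5 e m ⊗ pow5 (D ⊗ (ι (suc r) ⊝ Q) ⊕ QL) m
        ≡⟨ cong₂ _⊕_ (sym (pow5-distrib-⊗ e _ m)) (sym (pow5-distrib-⊗ e _ m)) ⟩
      pow5 (e ⊗ (D ⊗ ι (suc r) ⊕ QL)) m ⊕ pow5 (e ⊗ (D ⊗ (ι (suc r) ⊝ Q) ⊕ QL)) m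
        ≡⟨ cong₂ (λ u v → pow5 (e ⊗ (D ⊗ ι (suc r) ⊕ u)) m ⊕ pow5 (e ⊗ (D ⊗ (ι (suc r) ⊝ Q) ⊕ v)) m) QL≡Q⊗L QL≡Q⊗L ⟩
      pow5 (e ⊗ (D ⊗ ι (suc r) ⊕ Q ⊗ L)) m ⊕ pow5 (e ⊗ (D ⊗ (ι (suc r) ⊝ Q) ⊕ Q ⊗ L)) m
        ≡⟨ cong₂ (λ u v → pow5 u m ⊕ pow5 v m) (e⊗[D⊗r⊕Q⊗L] (suc r)) (e⊗[D⊗[r⊝q]⊕Q⊗L] (suc r)) ⟩
      pow5 (L ⊕ ι (suc r) ⊗ (D ⊗ e)) m ⊕ pow5 (L ⊝ D ⊕ ι (suc r) ⊗ (D ⊗ e)) m ∎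
      where
      QL = embed (ℕ→ℚ q ℚ.* ℕ→ℚ (lucas j))
      QL≡Q⊗L : QL ≡ Q ⊗ L
      QL≡Q⊗L = embed-* (ℕ→ℚ q) (ℕ→ℚ (lucas j))

corollary20 : (s : Sign) (n j q : ℕ) → 1 ≤ n → 1 ≤ j → 2 ≤ q →
    lhs s n j q ≡ rhs s n j q
corollary20 s zero    j q       ()  _ _
corollary20 s (suc m) j zero    _   _ ()
corollary20 s (suc m) j (suc p) _   _ _ =
  ⊗-cancelˡ (±√5 s) (embed (+ 1 ℚ./ 5) ⊗ ±√5 s) (±√5/5⊗±√5≡1 s) (trans E⊗lhs (sym E⊗rhs))
  where open Corollary20 s m j p
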